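{- Every polymatroid game possesses a pure Nash equilibrium.
   Context: A polymatroid game is given as follows. There is a finite set of players $N=\{1,\dots,n\}$ and a finite set of resources $E=\{1,\dots,m\}$. Each player $i$ has a demand $d_i\in\mathbb{N}$ and an integral polymatroid rank function $f_i:2^E\to\mathbb{N}$ (submodular, monotone, $f_i(\emptyset)=0$) with $d_i\le f_i(E)$. The strategy set of player $i$ is $X_i=\mathbb{B}_{f_i}(d_i)=\{\mathbf{x}_i\in\mathbb{N}^E:\sum_{e\in U}x_{i,e}\le f_i(U)\ \forall U\subseteq E,\ \sum_{e\in E}x_{i,e}=d_i\}$. For a profile $\mathbf{x}=(\mathbf{x}_i)_{i\in N}\in X_1\times\dots\times X_n$, with $x_{ -i,e}=\sum_{j\ne i}x_{j,e}$, the private cost of player $i$ is $\pi_i(\mathbf{x})=\sum_{e\in E}C_{i,e}(x_{i,e};x_{ -i,e})$, where each $C_{i,e}:\mathbb{N}\times\mathbb{N}\to\mathbb{R}_+$ is regular: with $C^-(x;t)=C(x;t)-C(x-1;t)$ for $x\ge 1$, $C^-(x;t)\le C^-(x;t+1)$ and $C^-(x;t+1)\le C^-(x+1;t)$ for all $x,t\in\mathbb{N}$ (where defined). A pure Nash equilibrium is a profile $\mathbf{x}$ such that for every $i$ and every $\mathbf{y}_i\in X_i$, $\pi_i(\mathbf{x})\le\pi_i(\mathbf{y}_i,\mathbf{x}_{ -i})$.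
   Formalization: The cost functions $C_{i,e}$ take values in the nonnegative rationals rather than in $\mathbb{R}_+$. -}

module Defs where

open import Data.Nat as ℕ using (ℕ; zero; suc)
open import Data.Fin using (Fin; zero; suc)
open import Data.Fin.Properties using (_≟_)
open import Data.Fin.Subset as Sub using (Subset; _∪_; _∩_; _⊆_)
open import Data.Vec using (lookup)
open import Data.Bool using (if_then_else_)
open import Data.Rational as ℚ using (ℚ; 0ℚ)
open import Data.Product using (_×_)
open import Relation.Binary.PropositionalEquality using (_≡_)
open import Relation.Nullary using (yes; no)

Σℕ : (k : ℕ) → (Fin k → ℕ) → ℕ
Σℕ zero    g = 0
Σℕ (suc k) g = g zero ℕ.+ Σℕ k (λ j → g (suc j))

Σℚ : (k : ℕ) → (Fin k → ℚ) → ℚ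
Σℚ zero    g = 0ℚ
Σℚ (suc k) g = g zero ℚ.+ Σℚ k (λ j → g (suc j))

sumOver : {m : ℕ} → Subset m → (Fin m → ℕ) → ℕ
sumOver {m} U x = Σℕ m (λ e → if lookup U e then x e else 0)

record IsPolymatroidRank {m : ℕ} (f : Subset m → ℕ) : Set where
  field
    normalized  : f Sub.⊥ ≡ 0
    monotone    : ∀ A B → A ⊆ B → f A ℕ.≤ f B
    submodular  : ∀ A B → f (A ∪ B) ℕ.+ f (A ∩ B) ℕ.≤ f A ℕ.+ f B

InBase : {m : ℕ} → (Subset m → ℕ) → ℕ → (Fin m → ℕ) → Set
InBase {m} f d x = (∀ U → sumOver U x ℕ.≤ f U) × (Σℕ m x ≡ d)

marg : (ℕ → ℕ → ℚ) → ℕ → ℕ → ℚ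
marg C x t = C (suc x) t ℚ.- C x t

-- regular cost function (C⁻(x;t) defined for x ≥ 1, written as x+1)
record IsRegular (C : ℕ → ℕ → ℚ) : Set where
  field
    nonneg : ∀ x t → 0ℚ ℚ.≤ C x t
    mono-t : ∀ x t → marg C x t ℚ.≤ marg C x (suc t)
    swap   : ∀ x t → marg C x (suc t) ℚ.≤ marg C (suc x) t

record PolymatroidGame (n m : ℕ) : Set where
  field
    d      : Fin n → ℕ
    f      : Fin n → Subset m → ℕ
    f-poly : ∀ i → IsPolymatroidRank (f i)
    d≤fE   : ∀ i → d i ℕ.≤ f i Sub.⊤
    C      : Fin n → Fin m → ℕ → ℕ → ℚ
    C-reg  : ∀ i e → IsRegular (C i e)

Profile : ℕ → ℕ → Set
Profile n m = Fin n → Fin m → ℕ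

others : {n m : ℕ} → Profile n m → Fin n → Fin m → ℕ
others {n} x i e = Σℕ n (λ j → if Relation.Nullary.does (j ≟ i) then 0 else x j e)
  where import Relation.Nullary

deviate : {n m : ℕ} → Profile n m → Fin n → (Fin m → ℕ) → Profile n m
deviate x i y j with j ≟ i
... | yes _ = y
... | no  _ = x j

module _ {n m : ℕ} (G : PolymatroidGame n m) where
  open PolymatroidGame G

  Feasible : Profile n m → Set
  Feasible x = ∀ i → InBase (f i) (d i) (x i)

  privateCost : Profile n m → Fin n → ℚ
  privateCost x i = Σℚ m (λ e → C i e (x i e) (others x i e))

  IsPureNE : Profile n m → Set
  IsPureNE x = Feasible x ×
    (∀ i (y : Fin m → ℕ) → InBase (f i) (d i) y →
       privateCost x i ℚ.≤ privateCost (deviate x i y) i)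

{-# OPTIONS --safe #-}

-- Demands are raised one unit at a time while an equilibrium is maintained.  Against fixed
-- loads of the others, a player's cost is a separable convex function on the integral bases of
-- her polymatroid, so a strategy is a best response as soon as no single-unit exchange a → c
-- improves it; this local-to-global step is proved with tight sets.  A new unit is put on a
-- cheapest resource g; by regularity the receiving player stays stable, and the others can only
-- want to move units away from the resource whose load went up.  Invariant: every player is
-- stable against loads L, and the actual loads are L plus one unit on a resource h.  A player who
-- wants to leave h moves one unit from h to her cheapest admissible resource b; she then is
-- stable against L again, the surplus unit now sits on b, and a potential ranking the marginal
-- costs of held units strictly drops.  When nobody wants to move, the profile is an equilibrium.
module Submission where

open import Defs
open import Data.Nat using (ℕ; zero; suc; pred; >-nonZero; _+_; _∸_; _⊓_; _≤_; _<_; _≤′_; _≤?_; _<?_; z≤n; s≤s)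
open import Data.Nat.Base using (≤′-reflexive; ≤′-step)
open import Data.Nat.Induction using (<-wellFounded)
open import Induction.WellFounded using (Acc; acc)
open import Data.Nat.Properties hiding (_≟_)
open import Data.Fin using (Fin; zero; suc; toℕ; fromℕ<)
open import Data.Fin.Properties as Finₚ using (_≟_; any?; toℕ-fromℕ<)
open import Data.Product using (∃; ∃₂; _×_; _,_; proj₁; proj₂)
open import Data.Sum using (_⊎_; inj₁; inj₂; [_,_]′)
open import Data.Empty using (⊥; ⊥-elim)
open import Data.Unit using (⊤; tt)
open import Relation.Unary using (Decidable)
open import Data.Bool using (true; false; if_then_else_; _∨_; _∧_)
open import Data.Vec using (lookup)
open import Data.Vec.Properties using ([]=⇒lookup; lookup⇒[]=; lookup-zipWith; lookup-replicate)
open import Data.Vec.Functional using (Vector; updateAt)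
open import Data.Vec.Functional.Properties using (updateAt-updates; updateAt-minimal; updateAt-updateAt-local; updateAt-updateAt; updateAt-id)
open import Data.Fin.Subset as Sub using (Subset; _∈_; _∉_; _∪_; _∩_)
open import Data.Fin.Subset.Properties
  using (∈⊤; ∉⊥; p∩q⊆p; p∩q⊆q; _∈?_; anySubset?; x∈p∪q⁺; x∈p∪q⁻; x∈p∩q⁺; x∈p∩q⁻)
open import Data.List using (tabulate)
open import Function using (_∘_; id)
open import Relation.Binary.PropositionalEquality
open import Relation.Nullary using (¬_; Dec; yes; no; does; contradiction)
open import Relation.Nullary.Decidable using (_×-dec_; ¬?)
open import Algebra.Bundles using (CommutativeMonoid)
import Algebra.Properties.CommutativeSemigroup as CommSemigroupₚ
import Data.Rational as ℚ
import Data.Rational.Properties as ℚₚ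
open import Data.Rational.Solver using (module +-*-Solver)
open import Relation.Binary.Bundles using (TotalPreorder)
import Relation.Binary.Construct.Flip.EqAndOrd as Flip

open CommSemigroupₚ +-commutativeSemigroup using (xy∙z≈zy∙x; xy∙z≈xz∙y; xy∙z≈y∙xz; x∙yz≈y∙xz; interchange)
open CommSemigroupₚ (CommutativeMonoid.commutativeSemigroup ℚₚ.+-0-commutativeMonoid)
  using () renaming (xy∙z≈zy∙x to ℚ-xy∙z≈zy∙x)

-- Finite sums and unit moves

Σℕ-cong : ∀ k {g h : Fin k → ℕ} → g ≗ h → Σℕ k g ≡ Σℕ k h
Σℕ-cong zero    g≗h = refl
Σℕ-cong (suc k) g≗h = cong₂ _+_ (g≗h zero) (Σℕ-cong k (g≗h ∘ suc))

Σℕ-mono : ∀ k {g h : Fin k → ℕ} → (∀ i → g i ≤ h i) → Σℕ k g ≤ Σℕ k h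
Σℕ-mono zero    g≤h = z≤n
Σℕ-mono (suc k) g≤h = +-mono-≤ (g≤h zero) (Σℕ-mono k (g≤h ∘ suc))

Σℕ-mono-< : ∀ k {g h : Fin k → ℕ} i → (∀ j → g j ≤ h j) → g i < h i → Σℕ k g < Σℕ k h
Σℕ-mono-< (suc k) zero    g≤h gi<hi = +-mono-<-≤ gi<hi (Σℕ-mono k (g≤h ∘ suc))
Σℕ-mono-< (suc k) (suc i) g≤h gi<hi = +-mono-≤-< (g≤h zero) (Σℕ-mono-< k i (g≤h ∘ suc) gi<hi)

Σℕ-mono-≡⇒≗ : ∀ k {g h : Fin k → ℕ} → (∀ i → g i ≤ h i) → Σℕ k g ≡ Σℕ k h → g ≗ h
Σℕ-mono-≡⇒≗ k g≤h Σg≡Σh i with m≤n⇒m<n∨m≡n (g≤h i)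
... | inj₁ gi<hi = contradiction Σg≡Σh (<⇒≢ (Σℕ-mono-< k i g≤h gi<hi))
... | inj₂ gi≡hi = gi≡hi

Σℕ-distrib-+ : ∀ k (g h : Fin k → ℕ) → Σℕ k (λ i → g i + h i) ≡ Σℕ k g + Σℕ k h
Σℕ-distrib-+ zero    g h = refl
Σℕ-distrib-+ (suc k) g h =
  trans (cong (g zero + h zero +_) (Σℕ-distrib-+ k (g ∘ suc) (h ∘ suc))) (interchange (g zero) (h zero) _ _)

Σℕ-zero : ∀ k → Σℕ k (λ _ → 0) ≡ 0
Σℕ-zero zero    = refl
Σℕ-zero (suc k) = Σℕ-zero k

term≤Σℕ : ∀ k (g : Fin k → ℕ) i → g i ≤ Σℕ k g
term≤Σℕ (suc k) g zero    = m≤m+n _ _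
term≤Σℕ (suc k) g (suc i) = ≤-trans (term≤Σℕ k (g ∘ suc) i) (m≤n+m _ _)

Σℕ-positive : ∀ k (g : Fin k → ℕ) → 0 < Σℕ k g → ∃ λ i → 0 < g i
Σℕ-positive (suc k) g 0<Σ with g zero in eq
... | suc _ = zero , subst (0 <_) (sym eq) (s≤s z≤n)
... | zero  = let (i , 0<gi) = Σℕ-positive k (g ∘ suc) 0<Σ in suc i , 0<gi

Σℕ-agree-except : ∀ k (g h : Fin k → ℕ) e → (∀ i → i ≢ e → g i ≡ h i) →
                  Σℕ k g + h e ≡ Σℕ k h + g e
Σℕ-agree-except (suc k) g h zero g≡h =
  trans (cong (λ s → g zero + s + h zero) (Σℕ-cong k (λ i → g≡h (suc i) λ ())))
        (xy∙z≈zy∙x (g zero) (Σℕ k (h ∘ suc)) (h zero))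
Σℕ-agree-except (suc k) g h (suc e) g≡h = begin
  g zero + Σℕ k (g ∘ suc) + h (suc e)   ≡⟨ +-assoc (g zero) _ _ ⟩
  g zero + (Σℕ k (g ∘ suc) + h (suc e)) ≡⟨ cong₂ _+_ (g≡h zero λ ()) (Σℕ-agree-except k _ _ e g≡h′) ⟩
  h zero + (Σℕ k (h ∘ suc) + g (suc e)) ≡⟨ +-assoc (h zero) _ _ ⟨
  h zero + Σℕ k (h ∘ suc) + g (suc e)   ∎
  where
  open ≡-Reasoning
  g≡h′ : ∀ i → i ≢ e → g (suc i) ≡ h (suc i)
  g≡h′ i i≢e = g≡h (suc i) (i≢e ∘ Finₚ.suc-injective)

Σℚ-cong : ∀ k {g h : Fin k → ℚ.ℚ} → g ≗ h → Σℚ k g ≡ Σℚ k h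
Σℚ-cong zero    g≗h = refl
Σℚ-cong (suc k) g≗h = cong₂ ℚ._+_ (g≗h zero) (Σℚ-cong k (g≗h ∘ suc))

Σℚ-agree-except : ∀ k (g h : Fin k → ℚ.ℚ) e → (∀ i → i ≢ e → g i ≡ h i) →
                  Σℚ k g ℚ.+ h e ≡ Σℚ k h ℚ.+ g e
Σℚ-agree-except (suc k) g h zero g≡h =
  trans (cong (λ s → g zero ℚ.+ s ℚ.+ h zero) (Σℚ-cong k (λ i → g≡h (suc i) λ ())))
        (ℚ-xy∙z≈zy∙x (g zero) (Σℚ k (h ∘ suc)) (h zero))
Σℚ-agree-except (suc k) g h (suc e) g≡h = begin
  g zero ℚ.+ Σℚ k (g ∘ suc) ℚ.+ h (suc e)     ≡⟨ ℚₚ.+-assoc (g zero) _ _ ⟩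
  g zero ℚ.+ (Σℚ k (g ∘ suc) ℚ.+ h (suc e))   ≡⟨ cong₂ ℚ._+_ (g≡h zero λ ()) (Σℚ-agree-except k _ _ e g≡h′) ⟩
  h zero ℚ.+ (Σℚ k (h ∘ suc) ℚ.+ g (suc e))   ≡⟨ ℚₚ.+-assoc (h zero) _ _ ⟨
  h zero ℚ.+ Σℚ k (h ∘ suc) ℚ.+ g (suc e)     ∎
  where
  open ≡-Reasoning
  g≡h′ : ∀ i → i ≢ e → g (suc i) ≡ h (suc i)
  g≡h′ i i≢e = g≡h (suc i) (i≢e ∘ Finₚ.suc-injective)

module _ {m : ℕ} where

  inc dec : Vector ℕ m → Fin m → Vector ℕ m
  inc x e = updateAt x e suc
  dec x e = updateAt x e pred

  move : Vector ℕ m → Fin m → Fin m → Vector ℕ m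
  move x a c = inc (dec x a) c

  inc-dec : ∀ {x : Vector ℕ m} {e} → 1 ≤ x e → inc (dec x e) e ≗ x
  inc-dec {x} {e} 1≤xe i =
    trans (updateAt-updateAt-local e {h = id} x (suc-pred (x e) {{>-nonZero 1≤xe}}) i) (updateAt-id e x i)

  move-source : ∀ (x : Vector ℕ m) {a c} → a ≢ c → move x a c a ≡ pred (x a)
  move-source x {a} {c} a≢c = trans (updateAt-minimal a c (dec x a) a≢c) (updateAt-updates a x)

  move-target : ∀ (x : Vector ℕ m) {a c} → a ≢ c → move x a c c ≡ suc (x c)
  move-target x {a} {c} a≢c = trans (updateAt-updates c (dec x a)) (cong suc (updateAt-minimal c a x (a≢c ∘ sym)))

  move-other : ∀ (x : Vector ℕ m) {a c e} → e ≢ a → e ≢ c → move x a c e ≡ x e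
  move-other x {a} {c} {e} e≢a e≢c = trans (updateAt-minimal e c (dec x a) e≢c) (updateAt-minimal e a x e≢a)

  Σℕ-inc-step : ∀ (G r : Fin m → ℕ → ℕ) → (∀ e k → G e (suc k) ≡ G e k + r e k) → ∀ (v : Vector ℕ m) e →
                Σℕ m (λ i → G i (inc v e i)) ≡ Σℕ m (λ i → G i (v i)) + r e (v e)
  Σℕ-inc-step G r step v e = +-cancelʳ-≡ (G e (v e)) _ _ (begin
    ΣG (inc v e) + G e (v e)        ≡⟨ Σℕ-agree-except m _ _ e (λ i i≢e → cong (G i) (updateAt-minimal i e v i≢e)) ⟩
    ΣG v + G e (inc v e e)          ≡⟨ cong (λ k → ΣG v + G e k) (updateAt-updates e v) ⟩
    ΣG v + G e (suc (v e))          ≡⟨ cong (ΣG v +_) (trans (step e (v e)) (+-comm (G e (v e)) _)) ⟩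
    ΣG v + (r e (v e) + G e (v e))  ≡⟨ +-assoc (ΣG v) _ _ ⟨
    ΣG v + r e (v e) + G e (v e)    ∎)
    where
    open ≡-Reasoning
    ΣG : Vector ℕ m → ℕ
    ΣG w = Σℕ m (λ i → G i (w i))

  Σℕ-inc : ∀ (x : Vector ℕ m) e → Σℕ m (inc x e) ≡ suc (Σℕ m x)
  Σℕ-inc x e = trans (Σℕ-inc-step (λ _ k → k) (λ _ _ → 1) (λ _ k → +-comm 1 k) x e) (+-comm _ 1)

  Σℕ-dec : ∀ (x : Vector ℕ m) {e} → 1 ≤ x e → Σℕ m x ≡ suc (Σℕ m (dec x e))
  Σℕ-dec x {e} 1≤xe = trans (sym (Σℕ-cong m (inc-dec 1≤xe))) (Σℕ-inc (dec x e) e)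

  Σℕ-move : ∀ (x : Vector ℕ m) {a} c → 1 ≤ x a → Σℕ m (move x a c) ≡ Σℕ m x
  Σℕ-move x {a} c 1≤xa = trans (Σℕ-inc (dec x a) c) (sym (Σℕ-dec x 1≤xa))

  dec-inc : ∀ (x : Vector ℕ m) e → dec (inc x e) e ≗ x
  dec-inc x e i = trans (updateAt-updateAt e x i) (updateAt-id e x i)

  ≤-inc : ∀ (x : Vector ℕ m) e i → x i ≤ inc x e i
  ≤-inc x e i with i ≟ e
  ... | yes refl = ≤-trans (n≤1+n (x i)) (≤-reflexive (sym (updateAt-updates i x)))
  ... | no i≢e   = ≤-reflexive (sym (updateAt-minimal i e x i≢e))

  dec≤ : ∀ (x : Vector ℕ m) e i → dec x e i ≤ x i
  dec≤ x e i with i ≟ e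
  ... | yes refl = ≤-trans (≤-reflexive (updateAt-updates i x)) pred[n]≤n
  ... | no i≢e   = ≤-reflexive (updateAt-minimal i e x i≢e)

  updateAt-mono : ∀ {g : ℕ → ℕ} → (∀ {u v} → u ≤ v → g u ≤ g v) →
                  ∀ {x y : Vector ℕ m} e → (∀ i → x i ≤ y i) → ∀ i → updateAt x e g i ≤ updateAt y e g i
  updateAt-mono g-mono {x} {y} e x≤y i with i ≟ e
  ... | yes refl = subst₂ _≤_ (sym (updateAt-updates i x)) (sym (updateAt-updates i y)) (g-mono (x≤y i))
  ... | no i≢e   = subst₂ _≤_ (sym (updateAt-minimal i e x i≢e)) (sym (updateAt-minimal i e y i≢e)) (x≤y i)

  move-mono : ∀ {x y : Vector ℕ m} a c → (∀ i → x i ≤ y i) → ∀ i → move x a c i ≤ move y a c i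
  move-mono a c x≤y = updateAt-mono s≤s c (updateAt-mono pred-mono-≤ a x≤y)

-- Polymatroids and tight sets

module _ {m : ℕ} where

  restrict : Subset m → Vector ℕ m → Vector ℕ m
  restrict U x e = if lookup U e then x e else 0

  χ : Subset m → Fin m → ℕ
  χ U = restrict U (λ _ → 1)

  restrict-∈ : ∀ {U : Subset m} {e} (x : Vector ℕ m) → e ∈ U → restrict U x e ≡ x e
  restrict-∈ x e∈U rewrite []=⇒lookup e∈U = refl

  restrict-∉ : ∀ {U : Subset m} {e} (x : Vector ℕ m) → e ∉ U → restrict U x e ≡ 0
  restrict-∉ {U} {e} x e∉U with lookup U e in eq
  ... | true  = contradiction (lookup⇒[]= e U eq) e∉U
  ... | false = refl

  χ-∈ : ∀ {U : Subset m} {e} → e ∈ U → χ U e ≡ 1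
  χ-∈ = restrict-∈ _

  χ-∉ : ∀ {U : Subset m} {e} → e ∉ U → χ U e ≡ 0
  χ-∉ = restrict-∉ _

  χ≤1 : ∀ U e → χ U e ≤ 1
  χ≤1 U e with lookup U e
  ... | true  = ≤-refl
  ... | false = z≤n

  sumOver-cong : ∀ U {x y : Vector ℕ m} → x ≗ y → sumOver U x ≡ sumOver U y
  sumOver-cong U x≗y = Σℕ-cong m λ e → cong (λ v → if lookup U e then v else 0) (x≗y e)

  sumOver-mono : ∀ U {x y : Vector ℕ m} → (∀ e → x e ≤ y e) → sumOver U x ≤ sumOver U y
  sumOver-mono U x≤y = Σℕ-mono m λ e → restrict-mono (lookup U e) (x≤y e)
    where
    restrict-mono : ∀ b {u v} → u ≤ v → (if b then u else 0) ≤ (if b then v else 0)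
    restrict-mono true  u≤v = u≤v
    restrict-mono false _   = z≤n

  sumOver≤Σℕ : ∀ U (x : Vector ℕ m) → sumOver U x ≤ Σℕ m x
  sumOver≤Σℕ U x = Σℕ-mono m λ e → restrict≤ (lookup U e)
    where
    restrict≤ : ∀ b {u} → (if b then u else 0) ≤ u
    restrict≤ true  = ≤-refl
    restrict≤ false = z≤n

  sumOver-⊤ : ∀ (x : Vector ℕ m) → sumOver Sub.⊤ x ≡ Σℕ m x
  sumOver-⊤ x = Σℕ-cong m λ e → cong (λ b → if b then x e else 0) (lookup-replicate e true)

  sumOver-⊥ : ∀ (x : Vector ℕ m) → sumOver Sub.⊥ x ≡ 0
  sumOver-⊥ x = trans (Σℕ-cong m λ e → cong (λ b → if b then x e else 0) (lookup-replicate e false))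
                      (Σℕ-zero m)

  sumOver-∪∩ : ∀ U V (x : Vector ℕ m) → sumOver (U ∪ V) x + sumOver (U ∩ V) x ≡ sumOver U x + sumOver V x
  sumOver-∪∩ U V x = begin
    sumOver (U ∪ V) x + sumOver (U ∩ V) x                    ≡⟨ Σℕ-distrib-+ m _ _ ⟨
    Σℕ m (λ e → restrict (U ∪ V) x e + restrict (U ∩ V) x e) ≡⟨ Σℕ-cong m pointwise ⟩
    Σℕ m (λ e → restrict U x e + restrict V x e)             ≡⟨ Σℕ-distrib-+ m _ _ ⟩
    sumOver U x + sumOver V x                                ∎
    where
    open ≡-Reasoning
    pointwise : ∀ e → restrict (U ∪ V) x e + restrict (U ∩ V) x e ≡ restrict U x e + restrict V x e
    pointwise e rewrite lookup-zipWith _∨_ e U V | lookup-zipWith _∧_ e U V with lookup U e | lookup V e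
    ... | true  | true  = refl
    ... | true  | false = refl
    ... | false | true  = +-comm (x e) 0
    ... | false | false = refl

  sumOver-inc : ∀ U (x : Vector ℕ m) e → sumOver U (inc x e) ≡ χ U e + sumOver U x
  sumOver-inc U x e = +-cancelʳ-≡ (restrict U x e) _ _ (begin
    sumOver U (inc x e) + restrict U x e     ≡⟨ Σℕ-agree-except m _ _ e unchanged ⟩
    sumOver U x + restrict U (inc x e) e     ≡⟨ cong (sumOver U x +_) restrict-inc ⟩
    sumOver U x + (χ U e + restrict U x e)   ≡⟨ +-assoc (sumOver U x) _ _ ⟨
    sumOver U x + χ U e + restrict U x e     ≡⟨ cong (_+ restrict U x e) (+-comm (sumOver U x) _) ⟩
    χ U e + sumOver U x + restrict U x e     ∎)
    where
    open ≡-Reasoning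
    unchanged : ∀ i → i ≢ e → restrict U (inc x e) i ≡ restrict U x i
    unchanged i i≢e = cong (λ v → if lookup U i then v else 0) (updateAt-minimal i e x i≢e)
    restrict-inc : restrict U (inc x e) e ≡ χ U e + restrict U x e
    restrict-inc rewrite updateAt-updates e {suc} x with lookup U e
    ... | true  = refl
    ... | false = refl

  sumOver-dec : ∀ U (x : Vector ℕ m) {e} → 1 ≤ x e → sumOver U x ≡ χ U e + sumOver U (dec x e)
  sumOver-dec U x {e} 1≤xe = trans (sumOver-cong U (sym ∘ inc-dec 1≤xe)) (sumOver-inc U (dec x e) e)

  sumOver-move : ∀ U (x : Vector ℕ m) {a} c → 1 ≤ x a →
                 χ U a + sumOver U (move x a c) ≡ χ U c + sumOver U x
  sumOver-move U x {a} c 1≤xa = begin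
    χ U a + sumOver U (move x a c)         ≡⟨ cong (χ U a +_) (sumOver-inc U (dec x a) c) ⟩
    χ U a + (χ U c + sumOver U (dec x a))  ≡⟨ x∙yz≈y∙xz (χ U a) (χ U c) _ ⟩
    χ U c + (χ U a + sumOver U (dec x a))  ≡⟨ cong (χ U c +_) (sumOver-dec U x 1≤xa) ⟨
    χ U c + sumOver U x                    ∎
    where open ≡-Reasoning

  sumOver-difference-< : ∀ {U V} {y z : Vector ℕ m} {e} → (∀ e → e ∈ U → e ∉ V → y e ≤ z e) →
                         e ∈ U → e ∉ V → y e < z e →
                         sumOver U y + sumOver (U ∩ V) z < sumOver U z + sumOver (U ∩ V) y
  sumOver-difference-< {U} {V} {y} {z} {e} y≤z e∈U e∉V ye<ze =
    subst₂ _<_ (Σℕ-distrib-+ m _ _) (Σℕ-distrib-+ m _ _) (Σℕ-mono-< m e pointwise strict)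
    where
    ∉∩ : ∀ {e} → e ∉ V → e ∉ U ∩ V
    ∉∩ e∉V = e∉V ∘ proj₂ ∘ x∈p∩q⁻ U V
    pointwise : ∀ e → restrict U y e + restrict (U ∩ V) z e ≤ restrict U z e + restrict (U ∩ V) y e
    pointwise e with e ∈? U | e ∈? V
    ... | no e∉U | _
      rewrite restrict-∉ y e∉U | restrict-∉ z (e∉U ∘ proj₁ ∘ x∈p∩q⁻ U V) = z≤n
    ... | yes e∈U | yes e∈V
      rewrite restrict-∈ y e∈U | restrict-∈ z e∈U
            | restrict-∈ z (x∈p∩q⁺ (e∈U , e∈V)) | restrict-∈ y (x∈p∩q⁺ (e∈U , e∈V)) = ≤-reflexive (+-comm (y e) (z e))
    ... | yes e∈U | no e∉V
      rewrite restrict-∈ y e∈U | restrict-∈ z e∈U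
            | restrict-∉ z (∉∩ e∉V) | restrict-∉ y (∉∩ e∉V) = +-monoˡ-≤ 0 (y≤z e e∈U e∉V)
    strict : restrict U y e + restrict (U ∩ V) z e < restrict U z e + restrict (U ∩ V) y e
    strict rewrite restrict-∈ y e∈U | restrict-∈ z e∈U
                 | restrict-∉ z (∉∩ e∉V) | restrict-∉ y (∉∩ e∉V) = +-monoˡ-< 0 ye<ze

  Independent : (Subset m → ℕ) → Vector ℕ m → Set
  Independent f x = ∀ U → sumOver U x ≤ f U

  Tight : (Subset m → ℕ) → Vector ℕ m → Subset m → Set
  Tight f x U = sumOver U x ≡ f U

  Independent-≤ : ∀ {f} {x y : Vector ℕ m} → (∀ e → x e ≤ y e) → Independent f y → Independent f x
  Independent-≤ x≤y y-ind U = ≤-trans (sumOver-mono U x≤y) (y-ind U)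

  violation? : ∀ (f : Subset m → ℕ) (x : Vector ℕ m) → Dec (∃ λ U → f U < sumOver U x)
  violation? f x = anySubset? λ U → f U <? sumOver U x

  Independent? : ∀ (f : Subset m → ℕ) (x : Vector ℕ m) → Dec (Independent f x)
  Independent? f x with violation? f x
  ... | yes (U , fU<xU) = no λ x-ind → <⇒≱ fU<xU (x-ind U)
  ... | no ¬violation   = yes λ U → ≮⇒≥ λ fU<xU → ¬violation (U , fU<xU)

  ¬Independent⇒violation : ∀ {f} {x : Vector ℕ m} → ¬ Independent f x → ∃ λ U → f U < sumOver U x
  ¬Independent⇒violation {f} {x} ¬ind with violation? f x
  ... | yes violation = violation
  ... | no ¬violation = contradiction (λ U → ≮⇒≥ λ fU<xU → ¬violation (U , fU<xU)) ¬ind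

  inc-violation⇒tight : ∀ {f} {x : Vector ℕ m} {e} → Independent f x → ¬ Independent f (inc x e) →
                        ∃ λ U → Tight f x U × e ∈ U
  inc-violation⇒tight {f} {x} {e} x-ind ¬ind =
    let (U , violated) = ¬Independent⇒violation ¬ind in separate U violated (e ∈? U)
    where
    separate : ∀ U → f U < sumOver U (inc x e) → Dec (e ∈ U) → ∃ λ U → Tight f x U × e ∈ U
    separate U violated (yes e∈U) = U , ≤-antisym (x-ind U) (≤-pred fU<1+xU) , e∈U
      where
      fU<1+xU : f U < suc (sumOver U x)
      fU<1+xU = subst (f U <_) (trans (sumOver-inc U x e) (cong (_+ sumOver U x) (χ-∈ e∈U))) violated
    separate U violated (no e∉U) = contradiction (x-ind U) (<⇒≱ fU<xU)
      where
      fU<xU : f U < sumOver U x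
      fU<xU = subst (f U <_) (trans (sumOver-inc U x e) (cong (_+ sumOver U x) (χ-∉ e∉U))) violated

  move-violation⇒tight : ∀ {f} {x : Vector ℕ m} {a c} → Independent f x → 1 ≤ x a →
                         ¬ Independent f (move x a c) → ∃ λ U → Tight f x U × c ∈ U × a ∉ U
  move-violation⇒tight {f} {x} {a} {c} x-ind 1≤xa ¬ind =
    let (U , violated) = ¬Independent⇒violation ¬ind in separate U violated (c ∈? U) (a ∈? U)
    where
    separate : ∀ U → f U < sumOver U (move x a c) → Dec (c ∈ U) → Dec (a ∈ U) →
               ∃ λ U → Tight f x U × c ∈ U × a ∉ U
    separate U violated (no c∉U) _ = contradiction (x-ind U) (<⇒≱ (<-≤-trans violated moved≤x))
      where
      moved≤x : sumOver U (move x a c) ≤ sumOver U x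
      moved≤x = ≤-trans (m≤n+m _ (χ U a))
                  (≤-reflexive (trans (sumOver-move U x c 1≤xa) (cong (_+ sumOver U x) (χ-∉ c∉U))))
    separate U violated (yes c∈U) (yes a∈U) = contradiction (x-ind U) (<⇒≱ (subst (f U <_) moved≡x violated))
      where
      moved≡x : sumOver U (move x a c) ≡ sumOver U x
      moved≡x = suc-injective (subst₂ (λ i j → i + sumOver U (move x a c) ≡ j + sumOver U x)
                                      (χ-∈ a∈U) (χ-∈ c∈U) (sumOver-move U x c 1≤xa))
    separate U violated (yes c∈U) (no a∉U) = U , ≤-antisym (x-ind U) (≤-pred (subst (f U <_) moved≡1+x violated)) , c∈U , a∉U
      where
      moved≡1+x : sumOver U (move x a c) ≡ suc (sumOver U x)
      moved≡1+x = subst₂ (λ i j → i + sumOver U (move x a c) ≡ j + sumOver U x)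
                         (χ-∉ a∉U) (χ-∈ c∈U) (sumOver-move U x c 1≤xa)

  independent-move : ∀ {f} {x : Vector ℕ m} {a c} → Independent f x → 1 ≤ x a →
                     (∀ U → Tight f x U → c ∈ U → a ∉ U → ⊥) → Independent f (move x a c)
  independent-move {f} {x} {a} {c} x-ind 1≤xa ¬separated with Independent? f (move x a c)
  ... | yes ind = ind
  ... | no ¬ind = let (U , tight-U , c∈U , a∉U) = move-violation⇒tight x-ind 1≤xa ¬ind in
                  ⊥-elim (¬separated U tight-U c∈U a∉U)

module _ {m : ℕ} where

  ∈⋃⁺ : ∀ {k} (F : Fin k → Subset m) i {e} → e ∈ F i → e ∈ Sub.⋃ (tabulate F)
  ∈⋃⁺ F zero    e∈Fi = x∈p∪q⁺ (inj₁ e∈Fi)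
  ∈⋃⁺ F (suc i) e∈Fi = x∈p∪q⁺ (inj₂ (∈⋃⁺ (F ∘ suc) i e∈Fi))

  ∈⋃⁻ : ∀ {k} (F : Fin k → Subset m) {e} → e ∈ Sub.⋃ (tabulate F) → ∃ λ i → e ∈ F i
  ∈⋃⁻ {zero}  F e∈⋃ = contradiction e∈⋃ ∉⊥
  ∈⋃⁻ {suc k} F e∈⋃ with x∈p∪q⁻ (F zero) _ e∈⋃
  ... | inj₁ e∈F0   = zero , e∈F0
  ... | inj₂ e∈rest = let (i , e∈Fi) = ∈⋃⁻ (F ∘ suc) e∈rest in suc i , e∈Fi

  ∈⋂⁺ : ∀ {k} (F : Fin k → Subset m) {e} → (∀ i → e ∈ F i) → e ∈ Sub.⋂ (tabulate F)
  ∈⋂⁺ {zero}  F e∈F = ∈⊤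
  ∈⋂⁺ {suc k} F e∈F = x∈p∩q⁺ (e∈F zero , ∈⋂⁺ (F ∘ suc) (e∈F ∘ suc))

  ∈⋂⁻ : ∀ {k} (F : Fin k → Subset m) {e} → e ∈ Sub.⋂ (tabulate F) → ∀ i → e ∈ F i
  ∈⋂⁻ {suc k} F e∈⋂ zero    = proj₁ (x∈p∩q⁻ (F zero) _ e∈⋂)
  ∈⋂⁻ {suc k} F e∈⋂ (suc i) = ∈⋂⁻ (F ∘ suc) (proj₂ (x∈p∩q⁻ (F zero) _ e∈⋂)) i

  record TightSeparator (f : Subset m → ℕ) (x : Vector ℕ m) (Y X : Fin m → Set) : Set where
    constructor separator
    field
      set      : Subset m
      tight    : Tight f x set
      includes : ∀ c → Y c → c ∈ set
      excludes : ∀ a → X a → a ∉ set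

open TightSeparator

point-separator : ∀ {m} {f : Subset m → ℕ} {x : Vector ℕ m} {a c} →
                  (∃ λ U → Tight f x U × c ∈ U × a ∉ U) → TightSeparator f x (_≡ c) (_≡ a)
point-separator (U , tight-U , c∈U , a∉U) = separator U tight-U (λ { _ refl → c∈U }) (λ { _ refl → a∉U })

module _ {m : ℕ} {f : Subset m → ℕ} (f-poly : IsPolymatroidRank f)
         {x : Vector ℕ m} (x-ind : Independent f x) where
  open IsPolymatroidRank f-poly

  tight-⊥ : Tight f x Sub.⊥
  tight-⊥ = trans (sumOver-⊥ x) (sym normalized)

  tight-∪∩ : ∀ {U V} → Tight f x U → Tight f x V → Tight f x (U ∪ V) × Tight f x (U ∩ V)
  tight-∪∩ {U} {V} tight-U tight-V =
    ≤-antisym (x-ind (U ∪ V)) (+-cancelʳ-≤ _ _ _ (≤-trans f∪+f∩≤ (+-monoʳ-≤ _ (x-ind (U ∩ V))))) ,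
    ≤-antisym (x-ind (U ∩ V)) (+-cancelˡ-≤ _ _ _ (≤-trans f∪+f∩≤ (+-monoˡ-≤ _ (x-ind (U ∪ V)))))
    where
    open ≤-Reasoning
    f∪+f∩≤ : f (U ∪ V) + f (U ∩ V) ≤ sumOver (U ∪ V) x + sumOver (U ∩ V) x
    f∪+f∩≤ = begin
      f (U ∪ V) + f (U ∩ V)                   ≤⟨ submodular U V ⟩
      f U + f V                               ≡⟨ cong₂ _+_ tight-U tight-V ⟨
      sumOver U x + sumOver V x               ≡⟨ sumOver-∪∩ U V x ⟨
      sumOver (U ∪ V) x + sumOver (U ∩ V) x   ∎

  ⋃-tight : ∀ {k} (F : Fin k → Subset m) → (∀ i → Tight f x (F i)) → Tight f x (Sub.⋃ (tabulate F))
  ⋃-tight {zero}  F _       = tight-⊥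
  ⋃-tight {suc k} F tight-F = proj₁ (tight-∪∩ (tight-F zero) (⋃-tight (F ∘ suc) (tight-F ∘ suc)))

  ⋂-tight : Tight f x Sub.⊤ → ∀ {k} (F : Fin k → Subset m) → (∀ i → Tight f x (F i)) →
            Tight f x (Sub.⋂ (tabulate F))
  ⋂-tight tight-⊤ {zero}  F _       = tight-⊤
  ⋂-tight tight-⊤ {suc k} F tight-F = proj₂ (tight-∪∩ (tight-F zero) (⋂-tight tight-⊤ (F ∘ suc) (tight-F ∘ suc)))

  ⋂-separator : Tight f x Sub.⊤ → ∀ {Y X : Fin m → Set} → Decidable X →
                (∀ a → X a → TightSeparator f x Y (_≡ a)) → TightSeparator f x Y X
  ⋂-separator tight-⊤ {Y} {X} X? separate =
    separator (Sub.⋂ (tabulate F)) (⋂-tight tight-⊤ F (tight ∘ piece))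
              (λ c Yc → ∈⋂⁺ F λ a → includes (piece a) c Yc)
              (λ a Xa a∈⋂ → excludes (piece a) a (refl , Xa) (∈⋂⁻ F a∈⋂ a))
    where
    piece′ : ∀ a → Dec (X a) → TightSeparator f x Y (λ a′ → a′ ≡ a × X a)
    piece′ a (yes Xa) = let S = separate a Xa in
      separator (set S) (tight S) (includes S) (λ a′ (a′≡a , _) → excludes S a′ a′≡a)
    piece′ a (no ¬Xa) = separator Sub.⊤ tight-⊤ (λ _ _ → ∈⊤) (λ _ (_ , Xa) → contradiction Xa ¬Xa)
    piece : ∀ a → TightSeparator f x Y (λ a′ → a′ ≡ a × X a)
    piece a = piece′ a (X? a)
    F : Fin m → Subset m
    F = set ∘ piece

  ⋃-separator : ∀ {Y X : Fin m → Set} → Decidable Y →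
                (∀ c → Y c → TightSeparator f x (_≡ c) X) → TightSeparator f x Y X
  ⋃-separator {Y} {X} Y? separate =
    separator (Sub.⋃ (tabulate F)) (⋃-tight F (tight ∘ piece))
              (λ c Yc → ∈⋃⁺ F c (includes (piece c) c (refl , Yc)))
              (λ a Xa a∈⋃ → let (c , a∈Fc) = ∈⋃⁻ F a∈⋃ in excludes (piece c) a Xa a∈Fc)
    where
    piece′ : ∀ c → Dec (Y c) → TightSeparator f x (λ c′ → c′ ≡ c × Y c) X
    piece′ c (yes Yc) = let S = separate c Yc in
      separator (set S) (tight S) (λ c′ (c′≡c , _) → includes S c′ c′≡c) (excludes S)
    piece′ c (no ¬Yc) = separator Sub.⊥ tight-⊥ (λ _ (_ , Yc) → contradiction Yc ¬Yc) (λ _ _ → ∉⊥)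
    piece : ∀ c → TightSeparator f x (λ c′ → c′ ≡ c × Y c) X
    piece c = piece′ c (Y? c)
    F : Fin m → Subset m
    F = set ∘ piece

  augmentation : Σℕ m x < f Sub.⊤ → ∃ λ e → Independent f (inc x e)
  augmentation Σx<f⊤ with any? (λ e → Independent? f (inc x e))
  ... | yes found = found
  ... | no ¬found = contradiction Σx<f⊤ (≤⇒≯ (begin
    f Sub.⊤             ≤⟨ monotone Sub.⊤ (set S) (λ {e} _ → includes S e tt) ⟩
    f (set S)           ≡⟨ tight S ⟨
    sumOver (set S) x   ≤⟨ sumOver≤Σℕ (set S) x ⟩
    Σℕ m x              ∎))
    where
    open ≤-Reasoning
    S : TightSeparator f x (λ _ → ⊤) (λ _ → ⊥)
    S = ⋃-separator (λ _ → yes tt) λ e _ →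
      let (U , tight-U , e∈U) = inc-violation⇒tight x-ind (λ ind → ¬found (e , ind)) in
      separator U tight-U (λ { _ refl → e∈U }) (λ _ ())

truncate : ∀ {m} {f : Subset m → ℕ} → IsPolymatroidRank f → ∀ d → IsPolymatroidRank (λ U → f U ⊓ d)
truncate {f = f} f-poly d = record
  { normalized = cong (_⊓ d) normalized
  ; monotone   = λ A B A⊆B → ⊓-monoˡ-≤ d (monotone A B A⊆B)
  ; submodular = submodular-⊓
  }
  where
  open IsPolymatroidRank f-poly
  open ≤-Reasoning
  submodular-⊓ : ∀ A B → f (A ∪ B) ⊓ d + f (A ∩ B) ⊓ d ≤ f A ⊓ d + f B ⊓ d
  submodular-⊓ A B with ≤-total (f A) d | ≤-total (f B) d
  ... | inj₁ fA≤d | inj₁ fB≤d = begin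
    f (A ∪ B) ⊓ d + f (A ∩ B) ⊓ d ≤⟨ +-mono-≤ (m⊓n≤m (f (A ∪ B)) d) (m⊓n≤m (f (A ∩ B)) d) ⟩
    f (A ∪ B) + f (A ∩ B)         ≤⟨ submodular A B ⟩
    f A + f B                     ≡⟨ cong₂ _+_ (m≤n⇒m⊓n≡m fA≤d) (m≤n⇒m⊓n≡m fB≤d) ⟨
    f A ⊓ d + f B ⊓ d             ∎
  ... | inj₁ fA≤d | inj₂ d≤fB = begin
    f (A ∪ B) ⊓ d + f (A ∩ B) ⊓ d ≤⟨ +-mono-≤ (m⊓n≤n (f (A ∪ B)) d)
                                             (≤-trans (m⊓n≤m (f (A ∩ B)) d) (monotone _ A (p∩q⊆p A B))) ⟩
    d + f A                       ≡⟨ +-comm d (f A) ⟩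
    f A + d                       ≡⟨ cong₂ _+_ (m≤n⇒m⊓n≡m fA≤d) (m≥n⇒m⊓n≡n d≤fB) ⟨
    f A ⊓ d + f B ⊓ d             ∎
  ... | inj₂ d≤fA | inj₁ fB≤d = begin
    f (A ∪ B) ⊓ d + f (A ∩ B) ⊓ d ≤⟨ +-mono-≤ (m⊓n≤n (f (A ∪ B)) d)
                                             (≤-trans (m⊓n≤m (f (A ∩ B)) d) (monotone _ B (p∩q⊆q A B))) ⟩
    d + f B                       ≡⟨ cong₂ _+_ (m≥n⇒m⊓n≡n d≤fA) (m≤n⇒m⊓n≡m fB≤d) ⟨
    f A ⊓ d + f B ⊓ d             ∎
  ... | inj₂ d≤fA | inj₂ d≤fB = begin
    f (A ∪ B) ⊓ d + f (A ∩ B) ⊓ d ≤⟨ +-mono-≤ (m⊓n≤n (f (A ∪ B)) d) (m⊓n≤n (f (A ∩ B)) d) ⟩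
    d + d                         ≡⟨ cong₂ _+_ (m≥n⇒m⊓n≡n d≤fA) (m≥n⇒m⊓n≡n d≤fB) ⟨
    f A ⊓ d + f B ⊓ d             ∎

module _ {m : ℕ} {f : Subset m → ℕ} {d : ℕ} {x : Vector ℕ m} where

  Independent-⊓ : Independent f x → Σℕ m x ≤ d → Independent (λ U → f U ⊓ d) x
  Independent-⊓ x-ind Σx≤d U = ⊓-glb (x-ind U) (≤-trans (sumOver≤Σℕ U x) Σx≤d)

  Independent-⊓⁻ : Independent (λ U → f U ⊓ d) x → Independent f x
  Independent-⊓⁻ x-ind U = ≤-trans (x-ind U) (m⊓n≤m _ d)

  tight-⊤-⊓ : d ≤ f Sub.⊤ → Σℕ m x ≡ d → Tight (λ U → f U ⊓ d) x Sub.⊤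
  tight-⊤-⊓ d≤f⊤ Σx≡d = trans (sumOver-⊤ x) (trans Σx≡d (sym (m≥n⇒m⊓n≡n d≤f⊤)))

-- z (U ∖ V) ≤ y (U ∖ V), written without subtraction.
tight-difference : ∀ {m} {g : Subset m → ℕ} → IsPolymatroidRank g → ∀ {y z : Vector ℕ m} {U V} →
                   Independent g y → Independent g z → Tight g y U → Tight g z V →
                   sumOver U z + sumOver (U ∩ V) y ≤ sumOver U y + sumOver (U ∩ V) z
tight-difference {g = g} g-poly {y} {z} {U} {V} y-ind z-ind tight-U tight-V =
  +-cancelʳ-≤ (sumOver V z) _ _ (begin
    sumOver U z + sumOver (U ∩ V) y + sumOver V z               ≡⟨ xy∙z≈xz∙y (sumOver U z) _ _ ⟩
    sumOver U z + sumOver V z + sumOver (U ∩ V) y               ≡⟨ cong (_+ sumOver (U ∩ V) y) (sumOver-∪∩ U V z) ⟨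
    sumOver (U ∪ V) z + sumOver (U ∩ V) z + sumOver (U ∩ V) y   ≤⟨ +-mono-≤ (+-monoˡ-≤ _ (z-ind (U ∪ V))) (y-ind (U ∩ V)) ⟩
    g (U ∪ V) + sumOver (U ∩ V) z + g (U ∩ V)                   ≡⟨ xy∙z≈xz∙y (g (U ∪ V)) _ _ ⟩
    g (U ∪ V) + g (U ∩ V) + sumOver (U ∩ V) z                   ≤⟨ +-monoˡ-≤ _ (submodular U V) ⟩
    g U + g V + sumOver (U ∩ V) z                               ≡⟨ cong (_+ sumOver (U ∩ V) z) (cong₂ _+_ tight-U tight-V) ⟨
    sumOver U y + sumOver V z + sumOver (U ∩ V) z               ≡⟨ xy∙z≈xz∙y (sumOver U y) _ _ ⟩
    sumOver U y + sumOver (U ∩ V) z + sumOver V z               ∎)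
  where
  open IsPolymatroidRank g-poly
  open ≤-Reasoning

-- Separable convex functions on polymatroid bases

ℚ-+-cancelʳ-≤ : ∀ r {p q} → p ℚ.+ r ℚ.≤ q ℚ.+ r → p ℚ.≤ q
ℚ-+-cancelʳ-≤ r {p} {q} p+r≤q+r = begin
  p               ≡⟨ +-−-cancel p r ⟨
  p ℚ.+ r ℚ.- r   ≤⟨ ℚₚ.+-monoˡ-≤ (ℚ.- r) p+r≤q+r ⟩
  q ℚ.+ r ℚ.- r   ≡⟨ +-−-cancel q r ⟩
  q               ∎
  where
  open ℚₚ.≤-Reasoning
  open +-*-Solver
  +-−-cancel : ∀ p r → p ℚ.+ r ℚ.- r ≡ p
  +-−-cancel = solve 2 (λ p r → p :+ r :- r := p) refl

balanced-≤ : ∀ {p q x y} → p ℚ.+ x ≡ q ℚ.+ y → y ℚ.≤ x → p ℚ.≤ q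
balanced-≤ {p} {q} {x} {y} p+x≡q+y y≤x =
  ℚ-+-cancelʳ-≤ x (ℚₚ.≤-trans (ℚₚ.≤-reflexive p+x≡q+y) (ℚₚ.+-monoʳ-≤ q y≤x))

compose-balances : ∀ {P D Z u v s t} → P ℚ.+ u ≡ D ℚ.+ v → D ℚ.+ s ≡ Z ℚ.+ t →
                   P ℚ.+ (s ℚ.- t) ≡ Z ℚ.+ (v ℚ.- u)
compose-balances {P} {D} {Z} {u} {v} {s} {t} P+u≡D+v D+s≡Z+t = begin
  P ℚ.+ (s ℚ.- t)                         ≡⟨ step₁ P u s t ⟩
  P ℚ.+ u ℚ.+ (s ℚ.- t) ℚ.- u             ≡⟨ cong (λ w → w ℚ.+ (s ℚ.- t) ℚ.- u) P+u≡D+v ⟩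
  D ℚ.+ v ℚ.+ (s ℚ.- t) ℚ.- u             ≡⟨ step₂ D v s t u ⟩
  D ℚ.+ s ℚ.+ (v ℚ.- u) ℚ.- t             ≡⟨ cong (λ w → w ℚ.+ (v ℚ.- u) ℚ.- t) D+s≡Z+t ⟩
  Z ℚ.+ t ℚ.+ (v ℚ.- u) ℚ.- t             ≡⟨ step₃ Z t v u ⟩
  Z ℚ.+ (v ℚ.- u)                         ∎
  where
  open ≡-Reasoning
  open +-*-Solver
  step₁ : ∀ P u s t → P ℚ.+ (s ℚ.- t) ≡ P ℚ.+ u ℚ.+ (s ℚ.- t) ℚ.- u
  step₁ = solve 4 (λ P u s t → P :+ (s :- t) := P :+ u :+ (s :- t) :- u) refl
  step₂ : ∀ D v s t u → D ℚ.+ v ℚ.+ (s ℚ.- t) ℚ.- u ≡ D ℚ.+ s ℚ.+ (v ℚ.- u) ℚ.- t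
  step₂ = solve 5 (λ D v s t u → D :+ v :+ (s :- t) :- u := D :+ s :+ (v :- u) :- t) refl
  step₃ : ∀ Z t v u → Z ℚ.+ t ℚ.+ (v ℚ.- u) ℚ.- t ≡ Z ℚ.+ (v ℚ.- u)
  step₃ = solve 4 (λ Z t v u → Z :+ t :+ (v :- u) :- t := Z :+ (v :- u)) refl

module _ {c ℓ₁ ℓ₂} (O : TotalPreorder c ℓ₁ ℓ₂) where
  open TotalPreorder O using (_≲_; total) renaming (Carrier to A; refl to ≲-refl; trans to ≲-trans)

  IsArgmin : ∀ {m} → (Fin m → Set) → (Fin m → A) → Fin m → Set ℓ₂
  IsArgmin P key b = P b × ∀ c → P c → key b ≲ key c

  least : ∀ {m} {P : Fin m → Set} → Decidable P → (key : Fin m → A) → (∀ c → ¬ P c) ⊎ ∃ (IsArgmin P key)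
  least {zero}  P? key = inj₁ λ ()
  least {suc m} P? key with P? zero | least (P? ∘ suc) (key ∘ suc)
  ... | no ¬P0 | inj₁ none          = inj₁ λ { zero → ¬P0 ; (suc c) → none c }
  ... | no ¬P0 | inj₂ (b , Pb , min) = inj₂ (suc b , Pb , λ { zero P0 → contradiction P0 ¬P0 ; (suc c) → min c })
  ... | yes P0 | inj₁ none          = inj₂ (zero , P0 , λ { zero _ → ≲-refl ; (suc c) Pc → contradiction Pc (none c) })
  ... | yes P0 | inj₂ (b , Pb , min) with total (key zero) (key (suc b))
  ...   | inj₁ k0≲kb = inj₂ (zero , P0 , λ { zero _ → ≲-refl ; (suc c) Pc → ≲-trans k0≲kb (min c Pc) })
  ...   | inj₂ kb≲k0 = inj₂ (suc b , Pb , λ { zero _ → kb≲k0 ; (suc c) Pc → min c Pc })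

  argmin : ∀ {m} {P : Fin m → Set} → Decidable P → (key : Fin m → A) → ∃ P → ∃ (IsArgmin P key)
  argmin P? key (c , Pc) with least P? key
  ... | inj₁ none  = contradiction Pc (none c)
  ... | inj₂ found = found

argminℚ : ∀ {m} {P : Fin m → Set} → Decidable P → (key : Fin m → ℚ.ℚ) → ∃ P →
          ∃ λ b → P b × ∀ c → P c → key b ℚ.≤ key c
argminℚ = argmin ℚₚ.≤-totalPreorder

argmaxℚ : ∀ {m} {P : Fin m → Set} → Decidable P → (key : Fin m → ℚ.ℚ) → ∃ P →
          ∃ λ b → P b × ∀ c → P c → key c ℚ.≤ key b
argmaxℚ = argmin (Flip.totalPreorder ℚₚ.≤-totalPreorder)

Δ : ∀ {m} → (Fin m → ℕ → ℚ.ℚ) → Fin m → ℕ → ℚ.ℚ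
Δ K e k = K e (suc k) ℚ.- K e k

pred∸<∸ : ∀ {n k} → k < n → pred n ∸ k < n ∸ k
pred∸<∸ {suc n} k<n = ∸-monoˡ-< (n<1+n n) (<⇒≤pred k<n)

module SeparableConvex {m : ℕ} {f : Subset m → ℕ} (f-poly : IsPolymatroidRank f) {d : ℕ} (d≤f⊤ : d ≤ f Sub.⊤)
                       (K : Fin m → ℕ → ℚ.ℚ) (convex : ∀ e k → Δ K e k ℚ.≤ Δ K e (suc k)) where

  Φ : Vector ℕ m → ℚ.ℚ
  Φ x = Σℚ m (λ e → K e (x e))

  LocallyOptimal : Vector ℕ m → Set
  LocallyOptimal y = ∀ a c → a ≢ c → 1 ≤ y a → Independent f (move y a c) →
                     Δ K a (pred (y a)) ℚ.≤ Δ K c (y c)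

  Δ-mono : ∀ e {k l} → k ≤ l → Δ K e k ℚ.≤ Δ K e l
  Δ-mono e = go ∘ ≤⇒≤′
    where
    go : ∀ {k l} → k ≤′ l → Δ K e k ℚ.≤ Δ K e l
    go (≤′-reflexive refl) = ℚₚ.≤-refl
    go (≤′-step k≤′l)      = ℚₚ.≤-trans (go k≤′l) (convex e _)

  -- If no candidate existed, U ∖ V would carry more of z than of y, contradicting
  -- tight-difference.  Truncating f at d makes the whole ground set tight for both bases.
  module Exchange {y z : Vector ℕ m} (y-base : InBase f d y) (y-opt : LocallyOptimal y) (z-base : InBase f d z)
                  {e : Fin m} (ye<ze : y e < z e)
                  (e-max : ∀ c → y c < z c → Δ K c (y c) ℚ.≤ Δ K e (y e)) where

    g : Subset m → ℕ
    g U = f U ⊓ d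

    y-ind : Independent g y
    y-ind = Independent-⊓ (proj₁ y-base) (≤-reflexive (proj₂ y-base))

    z-ind : Independent g z
    z-ind = Independent-⊓ (proj₁ z-base) (≤-reflexive (proj₂ z-base))

    θ : ℚ.ℚ
    θ = Δ K e (y e)

    Expensive Blocked Candidate : Fin m → Set
    Expensive a = 1 ≤ y a × θ ℚ.< Δ K a (pred (y a))
    Blocked   a = z a < y a × ¬ Independent f (move z e a)
    Candidate a = z a < y a × Independent f (move z e a) × Δ K a (pred (y a)) ℚ.≤ θ

    U : TightSeparator g y (λ c → y c < z c) Expensive
    U = ⋃-separator (truncate f-poly d) y-ind (λ c → y c <? z c) λ c yc<zc →
          ⋂-separator (truncate f-poly d) y-ind (tight-⊤-⊓ {f = f} d≤f⊤ (proj₂ y-base))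
                      (λ a → 1 ≤? y a ×-dec θ ℚₚ.<? Δ K a (pred (y a)))
                      (λ a (1≤ya , θ<Δa) → point-separator
                         (move-violation⇒tight y-ind 1≤ya (¬exchange c yc<zc 1≤ya θ<Δa ∘ Independent-⊓⁻)))
      where
      ¬exchange : ∀ c → y c < z c → ∀ {a} → 1 ≤ y a → θ ℚ.< Δ K a (pred (y a)) → ¬ Independent f (move y a c)
      ¬exchange c yc<zc {a} 1≤ya θ<Δa ind = ℚₚ.<-irrefl refl (ℚₚ.<-≤-trans θ<Δa (ℚₚ.≤-trans Δa≤Δc (e-max c yc<zc)))
        where
        Δa≤Δc : Δ K a (pred (y a)) ℚ.≤ Δ K c (y c)
        Δa≤Δc with a ≟ c
        ... | yes refl = Δ-mono a pred[n]≤n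
        ... | no a≢c   = y-opt a c a≢c 1≤ya ind

    V : TightSeparator g z Blocked (_≡ e)
    V = ⋃-separator (truncate f-poly d) z-ind (λ a → z a <? y a ×-dec ¬? (Independent? f (move z e a)))
          λ a (_ , ¬ind) → point-separator (move-violation⇒tight z-ind (≤-trans (s≤s z≤n) ye<ze) (¬ind ∘ Independent-⊓⁻))

    y≤z-on-U∖V : ¬ ∃ Candidate → ∀ a → a ∈ set U → a ∉ set V → y a ≤ z a
    y≤z-on-U∖V none a a∈U a∉V with z a <? y a
    ... | no za≮ya = ≮⇒≥ za≮ya
    ... | yes za<ya with Independent? f (move z e a)
    ...   | no ¬ind = contradiction (includes V a (za<ya , ¬ind)) a∉V
    ...   | yes ind = contradiction a∈U
                        (excludes U a (≤-trans (s≤s z≤n) za<ya , ℚₚ.≰⇒> λ Δa≤θ → none (a , za<ya , ind , Δa≤θ)))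

    candidate : ∃ Candidate
    candidate with any? (λ a → z a <? y a ×-dec Independent? f (move z e a) ×-dec Δ K a (pred (y a)) ℚₚ.≤? θ)
    ... | yes found = found
    ... | no none   = contradiction (tight-difference (truncate f-poly d) y-ind z-ind (tight U) (tight V))
                        (<⇒≱ (sumOver-difference-< (y≤z-on-U∖V none) (includes U e ye<ze) (excludes V e refl) ye<ze))

  improving-exchange : ∀ {y z} → InBase f d y → LocallyOptimal y → InBase f d z → ∀ {e₀} → y e₀ < z e₀ →
                       ∃₂ λ e a → y e < z e × z a < y a × Independent f (move z e a) ×
                                  Δ K a (pred (y a)) ℚ.≤ Δ K e (y e)
  improving-exchange {y} {z} y-base y-opt z-base y<z₀ =
    let (e , ye<ze , e-max) = argmaxℚ (λ c → y c <? z c) (λ c → Δ K c (y c)) (_ , y<z₀)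
        (a , za<ya , ind , Δa≤Δe) = Exchange.candidate y-base y-opt z-base ye<ze e-max
    in e , a , ye<ze , za<ya , ind , Δa≤Δe

  Φ-move : ∀ (z : Vector ℕ m) {e a} → e ≢ a → 1 ≤ z e →
           Φ (move z e a) ℚ.+ Δ K e (pred (z e)) ≡ Φ z ℚ.+ Δ K a (z a)
  Φ-move z {e} {a} e≢a 1≤ze = compose-balances {Φ (move z e a)} {Φ z₁} {Φ z} {K a (z a)} {K a (suc (z a))}
                                                {K e (suc (pred (z e)))} {K e (pred (z e))} into-a out-of-e
    where
    z₁ : Vector ℕ m
    z₁ = dec z e
    into-a : Φ (move z e a) ℚ.+ K a (z a) ≡ Φ z₁ ℚ.+ K a (suc (z a))
    into-a = subst₂ (λ u v → Φ (move z e a) ℚ.+ K a u ≡ Φ z₁ ℚ.+ K a v)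
                    (updateAt-minimal a e z (e≢a ∘ sym))
                    (trans (updateAt-updates a z₁) (cong suc (updateAt-minimal a e z (e≢a ∘ sym))))
                    (Σℚ-agree-except m _ _ a λ i i≢a → cong (K i) (updateAt-minimal i a z₁ i≢a))
    out-of-e : Φ z₁ ℚ.+ K e (suc (pred (z e))) ≡ Φ z ℚ.+ K e (pred (z e))
    out-of-e = subst₂ (λ u v → Φ z₁ ℚ.+ K e u ≡ Φ z ℚ.+ K e v)
                      (sym (suc-pred (z e) {{>-nonZero 1≤ze}}))
                      (updateAt-updates e z)
                      (Σℚ-agree-except m _ _ e λ i i≢e → cong (K i) (updateAt-minimal i e z i≢e))

  Φ-move-≤ : ∀ {y z : Vector ℕ m} {e a} → y e < z e → z a < y a →
             Δ K a (pred (y a)) ℚ.≤ Δ K e (y e) → Φ (move z e a) ℚ.≤ Φ z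
  Φ-move-≤ {y} {z} {e} {a} ye<ze za<ya Δa≤Δe =
    balanced-≤ (Φ-move z e≢a (≤-trans (s≤s z≤n) ye<ze)) (begin
      Δ K a (z a)          ≤⟨ Δ-mono a (<⇒≤pred za<ya) ⟩
      Δ K a (pred (y a))   ≤⟨ Δa≤Δe ⟩
      Δ K e (y e)          ≤⟨ Δ-mono e (<⇒≤pred ye<ze) ⟩
      Δ K e (pred (z e))   ∎)
    where
    open ℚₚ.≤-Reasoning
    e≢a : e ≢ a
    e≢a refl = <-asym ye<ze za<ya

  excess : Vector ℕ m → Vector ℕ m → ℕ
  excess y z = Σℕ m (λ i → z i ∸ y i)

  excess-move : ∀ {y z : Vector ℕ m} {e a} → y e < z e → z a < y a → excess y (move z e a) < excess y z
  excess-move {y} {z} {e} {a} ye<ze za<ya = Σℕ-mono-< m e pointwise strict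
    where
    e≢a : e ≢ a
    e≢a refl = <-asym ye<ze za<ya
    pointwise : ∀ i → move z e a i ∸ y i ≤ z i ∸ y i
    pointwise i with i ≟ e | i ≟ a
    ... | yes refl | _        = ≤-trans (≤-reflexive (cong (_∸ y i) (move-source z e≢a))) (∸-monoˡ-≤ (y i) pred[n]≤n)
    ... | no _     | yes refl = ≤-trans (≤-reflexive (trans (cong (_∸ y i) (move-target z e≢a)) (m≤n⇒m∸n≡0 za<ya))) z≤n
    ... | no i≢e   | no i≢a   = ≤-reflexive (cong (_∸ y i) (move-other z i≢e i≢a))
    strict : move z e a e ∸ y e < z e ∸ y e
    strict = subst (λ v → v ∸ y e < z e ∸ y e) (sym (move-source z e≢a)) (pred∸<∸ ye<ze)

  locally-optimal⇒optimal : ∀ {y} → InBase f d y → LocallyOptimal y → ∀ {z} → InBase f d z → Φ y ℚ.≤ Φ z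
  locally-optimal⇒optimal {y} y-base y-opt {z} z-base = go z-base (<-wellFounded (excess y z))
    where
    go : ∀ {z} → InBase f d z → Acc _<_ (excess y z) → Φ y ℚ.≤ Φ z
    go {z} z-base (acc smaller) with any? (λ i → y i <? z i)
    ... | yes (_ , y<z₀) =
      let (e , a , ye<ze , za<ya , ind , Δa≤Δe) = improving-exchange y-base y-opt z-base y<z₀
          z′-base = ind , trans (Σℕ-move z a (≤-trans (s≤s z≤n) ye<ze)) (proj₂ z-base)
      in ℚₚ.≤-trans (go z′-base (smaller (excess-move {y = y} {z = z} ye<ze za<ya))) (Φ-move-≤ {y = y} ye<ze za<ya Δa≤Δe)
    ... | no ¬y<z = ℚₚ.≤-reflexive (Σℚ-cong m λ i → cong (K i) (sym (z≗y i)))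
      where
      z≗y : z ≗ y
      z≗y = Σℕ-mono-≡⇒≗ m (λ i → ≮⇒≥ λ yi<zi → ¬y<z (i , yi<zi)) (trans (proj₂ z-base) (sym (proj₂ y-base)))

-- Regular marginal costs and stable strategies

record IsRegularMarginal (μ : ℕ → ℕ → ℚ.ℚ) : Set where
  field
    mono-level : ∀ k l → μ k l ℚ.≤ μ k (suc l)
    swap       : ∀ k l → μ k (suc l) ℚ.≤ μ (suc k) l

-- marginalTable C k l is the cost of a (k+1)-th own unit at level l, i.e. when the others hold
-- l − 1 units.  Level 0 (the others holding "−1" units) does occur in the algorithm; its value,
-- that of k ∸ 1 own units at level 1, is chosen to keep the table regular.
marginalTable : (ℕ → ℕ → ℚ.ℚ) → ℕ → ℕ → ℚ.ℚ
marginalTable C k zero    = marg C (pred k) 0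
marginalTable C k (suc t) = marg C k t

marginalTable-regular : ∀ {C} → IsRegular C → IsRegularMarginal (marginalTable C)
marginalTable-regular {C} C-reg = record { mono-level = mono-level ; swap = swap′ }
  where
  open IsRegular C-reg
  mono-level : ∀ k l → marginalTable C k l ℚ.≤ marginalTable C k (suc l)
  mono-level zero    zero    = ℚₚ.≤-refl
  mono-level (suc k) zero    = ℚₚ.≤-trans (mono-t k 0) (swap k 0)
  mono-level k       (suc l) = mono-t k l
  swap′ : ∀ k l → marginalTable C k (suc l) ℚ.≤ marginalTable C (suc k) l
  swap′ k zero    = ℚₚ.≤-refl
  swap′ k (suc l) = swap k l

module Stability {m : ℕ} (μ : Fin m → ℕ → ℕ → ℚ.ℚ) (μ-regular : ∀ e → IsRegularMarginal (μ e))
                 {f : Subset m → ℕ} (f-poly : IsPolymatroidRank f) where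

  open module μ-regular e = IsRegularMarginal (μ-regular e)

  μ⁺ μ⁻ : Vector ℕ m → Vector ℕ m → Fin m → ℚ.ℚ
  μ⁺ x lv c = μ c (x c) (lv c)
  μ⁻ x lv a = μ a (pred (x a)) (lv a)

  Stable : Vector ℕ m → Vector ℕ m → Set
  Stable x lv = ∀ a c → a ≢ c → 1 ≤ x a → Independent f (move x a c) → μ⁻ x lv a ℚ.≤ μ⁺ x lv c

  ImprovingMove : Vector ℕ m → Vector ℕ m → Fin m → Fin m → Set
  ImprovingMove x lv a c = a ≢ c × 1 ≤ x a × Independent f (move x a c) × μ⁺ x lv c ℚ.< μ⁻ x lv a

  improving? : ∀ x lv → Dec (∃₂ (ImprovingMove x lv))
  improving? x lv = any? λ a → any? λ c →
    ¬? (a ≟ c) ×-dec 1 ≤? x a ×-dec Independent? f (move x a c) ×-dec μ⁺ x lv c ℚₚ.<? μ⁻ x lv a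

  ¬improving⇒stable : ∀ {x lv} → ¬ ∃₂ (ImprovingMove x lv) → Stable x lv
  ¬improving⇒stable none a c a≢c 1≤xa ind = ℚₚ.≮⇒≥ λ μ⁺<μ⁻ → none (a , c , a≢c , 1≤xa , ind , μ⁺<μ⁻)

  Stable-≗ : ∀ {x lv lv′} → lv ≗ lv′ → Stable x lv → Stable x lv′
  Stable-≗ {x} lv≗lv′ stable a c a≢c 1≤xa ind =
    subst₂ (λ u v → μ a (pred (x a)) u ℚ.≤ μ c (x c) v) (lv≗lv′ a) (lv≗lv′ c) (stable a c a≢c 1≤xa ind)

  ImprovingMove-≗ : ∀ {x lv lv′ a c} → lv ≗ lv′ → ImprovingMove x lv a c → ImprovingMove x lv′ a c
  ImprovingMove-≗ {x} {a = a} {c} lv≗lv′ (a≢c , 1≤xa , ind , μ⁺<μ⁻) =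
    a≢c , 1≤xa , ind , subst₂ (λ u v → μ c (x c) u ℚ.< μ a (pred (x a)) v) (lv≗lv′ c) (lv≗lv′ a) μ⁺<μ⁻

  raised-improving-move : ∀ {x lv h a c} → Stable x lv → ImprovingMove x (inc lv h) a c →
                          a ≡ h × μ⁺ x lv c ℚ.< μ h (pred (x h)) (suc (lv h))
  raised-improving-move {x} {lv} {h} {a} {c} stable (a≢c , 1≤xa , ind , μ⁺<μ⁻) with a ≟ h
  ... | yes refl = refl , (begin-strict
    μ⁺ x lv c            ≡⟨ cong (μ c (x c)) (updateAt-minimal c a lv (a≢c ∘ sym)) ⟨
    μ⁺ x (inc lv a) c    <⟨ μ⁺<μ⁻ ⟩
    μ⁻ x (inc lv a) a    ≡⟨ cong (μ a (pred (x a))) (updateAt-updates a lv) ⟩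
    μ a (pred (x a)) (suc (lv a)) ∎)
    where open ℚₚ.≤-Reasoning
  ... | no a≢h = ⊥-elim (ℚₚ.<-irrefl refl (begin-strict
    μ⁻ x lv a            ≤⟨ stable a c a≢c 1≤xa ind ⟩
    μ⁺ x lv c            ≤⟨ raise c ⟩
    μ⁺ x (inc lv h) c    <⟨ μ⁺<μ⁻ ⟩
    μ⁻ x (inc lv h) a    ≡⟨ cong (μ a (pred (x a))) (updateAt-minimal a h lv a≢h) ⟩
    μ⁻ x lv a            ∎))
    where
    open ℚₚ.≤-Reasoning
    raise : ∀ e → μ⁺ x lv e ℚ.≤ μ⁺ x (inc lv h) e
    raise e with e ≟ h
    ... | yes refl = ℚₚ.≤-trans (mono-level e (x e) (lv e)) (ℚₚ.≤-reflexive (cong (μ e (x e)) (sym (updateAt-updates e lv))))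
    ... | no e≢h   = ℚₚ.≤-reflexive (cong (μ e (x e)) (sym (updateAt-minimal e h lv e≢h)))

  module Augment {x lv lv′ : Vector ℕ m} {g : Fin m} (stable : Stable x lv)
                 (g-min : ∀ c → Independent f (inc x c) → μ⁺ x lv g ℚ.≤ μ⁺ x lv c)
                 (lv-g : lv g ≡ suc (lv′ g)) (lv′-other : ∀ e → e ≢ g → lv′ e ≡ lv e) where

    x′ : Vector ℕ m
    x′ = inc x g

    μ⁻-other : ∀ {a} → a ≢ g → μ⁻ x′ lv′ a ≡ μ⁻ x lv a
    μ⁻-other {a} a≢g = cong₂ (λ k l → μ a (pred k) l) (updateAt-minimal a g x a≢g) (lv′-other a a≢g)

    μ⁺-other : ∀ {c} → c ≢ g → μ⁺ x′ lv′ c ≡ μ⁺ x lv c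
    μ⁺-other {c} c≢g = cong₂ (μ c) (updateAt-minimal c g x c≢g) (lv′-other c c≢g)

    1≤x-other : ∀ {a} → a ≢ g → 1 ≤ x′ a → 1 ≤ x a
    1≤x-other {a} a≢g = subst (1 ≤_) (updateAt-minimal a g x a≢g)

    out-of-g : ∀ c → c ≢ g → Independent f (move x′ g c) → μ⁻ x′ lv′ g ℚ.≤ μ⁺ x′ lv′ c
    out-of-g c c≢g ind = begin
      μ⁻ x′ lv′ g               ≡⟨ cong (λ k → μ g (pred k) (lv′ g)) (updateAt-updates g x) ⟩
      μ g (x g) (lv′ g)         ≤⟨ mono-level g (x g) (lv′ g) ⟩
      μ g (x g) (suc (lv′ g))   ≡⟨ cong (μ g (x g)) lv-g ⟨
      μ⁺ x lv g                 ≤⟨ g-min c (Independent-≤ (updateAt-mono s≤s c (≤-reflexive ∘ sym ∘ dec-inc x g)) ind) ⟩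
      μ⁺ x lv c                 ≡⟨ μ⁺-other c≢g ⟨
      μ⁺ x′ lv′ c               ∎
      where open ℚₚ.≤-Reasoning

    into-g : ∀ a → a ≢ g → 1 ≤ x′ a → Independent f (move x′ a g) → μ⁻ x′ lv′ a ℚ.≤ μ⁺ x′ lv′ g
    into-g a a≢g 1≤x′a ind = begin
      μ⁻ x′ lv′ a               ≡⟨ μ⁻-other a≢g ⟩
      μ⁻ x lv a                 ≤⟨ stable a g a≢g (1≤x-other a≢g 1≤x′a) (Independent-≤ (move-mono a g (≤-inc x g)) ind) ⟩
      μ⁺ x lv g                 ≡⟨ cong (μ g (x g)) lv-g ⟩
      μ g (x g) (suc (lv′ g))   ≤⟨ swap g (x g) (lv′ g) ⟩
      μ g (suc (x g)) (lv′ g)   ≡⟨ cong (λ k → μ g k (lv′ g)) (updateAt-updates g x) ⟨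
      μ⁺ x′ lv′ g               ∎
      where open ℚₚ.≤-Reasoning

    away-from-g : ∀ a c → a ≢ c → a ≢ g → c ≢ g → 1 ≤ x′ a → Independent f (move x′ a c) →
                  μ⁻ x′ lv′ a ℚ.≤ μ⁺ x′ lv′ c
    away-from-g a c a≢c a≢g c≢g 1≤x′a ind = begin
      μ⁻ x′ lv′ a   ≡⟨ μ⁻-other a≢g ⟩
      μ⁻ x lv a     ≤⟨ stable a c a≢c (1≤x-other a≢g 1≤x′a) (Independent-≤ (move-mono a c (≤-inc x g)) ind) ⟩
      μ⁺ x lv c     ≡⟨ μ⁺-other c≢g ⟨
      μ⁺ x′ lv′ c   ∎
      where open ℚₚ.≤-Reasoning

    stable-after : Stable x′ lv′
    stable-after a c a≢c with a ≟ g | c ≟ g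
    ... | yes refl | yes refl = contradiction refl a≢c
    ... | yes refl | no c≢g   = λ _ → out-of-g c c≢g
    ... | no a≢g   | yes refl = into-g a a≢g
    ... | no a≢g   | no c≢g   = away-from-g a c a≢c a≢g c≢g

  module BestMove {x lv lv′ : Vector ℕ m} {h b : Fin m}
                  (x-ind : Independent f x) (stable : Stable x lv)
                  (1≤xh : 1 ≤ x h) (b≢h : b ≢ h) (hb-ind : Independent f (move x h b))
                  (b-min : ∀ c → c ≢ h → Independent f (move x h c) → μ⁺ x lv b ℚ.≤ μ⁺ x lv c)
                  (b<h : μ⁺ x lv b ℚ.< μ h (pred (x h)) (suc (lv h)))
                  (lv′-h : lv′ h ≡ suc (lv h)) (lv-b : lv b ≡ suc (lv′ b))
                  (lv′-other : ∀ e → e ≢ h → e ≢ b → lv′ e ≡ lv e) where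

    x′ : Vector ℕ m
    x′ = move x h b

    h≢b : h ≢ b
    h≢b = b≢h ∘ sym

    1≤x-other : ∀ {a} → a ≢ h → a ≢ b → 1 ≤ x′ a → 1 ≤ x a
    1≤x-other a≢h a≢b = subst (1 ≤_) (move-other x a≢h a≢b)

    μ⁻-other : ∀ {a} → a ≢ h → a ≢ b → μ⁻ x′ lv′ a ≡ μ⁻ x lv a
    μ⁻-other {a} a≢h a≢b = cong₂ (λ k l → μ a (pred k) l) (move-other x a≢h a≢b) (lv′-other a a≢h a≢b)

    μ⁺-other : ∀ {c} → c ≢ h → c ≢ b → μ⁺ x′ lv′ c ≡ μ⁺ x lv c
    μ⁺-other {c} c≢h c≢b = cong₂ (μ c) (move-other x c≢h c≢b) (lv′-other c c≢h c≢b)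

    μ⁻-h : 1 ≤ x′ h → μ⁻ x′ lv′ h ℚ.≤ μ⁻ x lv h
    μ⁻-h 1≤x′h = begin
      μ⁻ x′ lv′ h                             ≡⟨ cong₂ (λ k l → μ h (pred k) l) (move-source x h≢b) lv′-h ⟩
      μ h (pred (pred (x h))) (suc (lv h))    ≤⟨ swap h _ (lv h) ⟩
      μ h (suc (pred (pred (x h)))) (lv h)    ≡⟨ cong (λ k → μ h k (lv h)) (suc-pred _ {{>-nonZero 1≤pred-xh}}) ⟩
      μ⁻ x lv h                               ∎
      where
      open ℚₚ.≤-Reasoning
      1≤pred-xh : 1 ≤ pred (x h)
      1≤pred-xh = subst (1 ≤_) (move-source x h≢b) 1≤x′h

    μ⁺-h : μ⁺ x lv b ℚ.< μ⁺ x′ lv′ h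
    μ⁺-h = ℚₚ.<-≤-trans b<h (ℚₚ.≤-reflexive (sym (cong₂ (μ h) (move-source x h≢b) lv′-h)))

    μ⁻-b : μ⁻ x′ lv′ b ℚ.≤ μ⁺ x lv b
    μ⁻-b = begin
      μ⁻ x′ lv′ b               ≡⟨ cong (λ k → μ b (pred k) (lv′ b)) (move-target x h≢b) ⟩
      μ b (x b) (lv′ b)         ≤⟨ mono-level b (x b) (lv′ b) ⟩
      μ b (x b) (suc (lv′ b))   ≡⟨ cong (μ b (x b)) lv-b ⟨
      μ⁺ x lv b                 ∎
      where open ℚₚ.≤-Reasoning

    μ⁺-b : μ⁺ x lv b ℚ.≤ μ⁺ x′ lv′ b
    μ⁺-b = begin
      μ⁺ x lv b                 ≡⟨ cong (μ b (x b)) lv-b ⟩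
      μ b (x b) (suc (lv′ b))   ≤⟨ swap b (x b) (lv′ b) ⟩
      μ b (suc (x b)) (lv′ b)   ≡⟨ cong (λ k → μ b k (lv′ b)) (move-target x h≢b) ⟨
      μ⁺ x′ lv′ b               ∎
      where open ℚₚ.≤-Reasoning

    -- A set that is tight for x cannot gain units under the double move x ↦ x′ ↦ move x′ a c.
    balance : ∀ {S a c} → Tight f x S → 1 ≤ x′ a → Independent f (move x′ a c) →
              χ S c + χ S b ≤ χ S a + χ S h
    balance {S} {a} {c} tight-S 1≤x′a ind = +-cancelʳ-≤ (sumOver S x) _ _ (begin
      χ S c + χ S b + sumOver S x                 ≡⟨ moved ⟨
      χ S a + χ S h + sumOver S (move x′ a c)     ≤⟨ +-monoʳ-≤ (χ S a + χ S h) (≤-trans (ind S) (≤-reflexive (sym tight-S))) ⟩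
      χ S a + χ S h + sumOver S x                 ∎)
      where
      open ≤-Reasoning
      moved : χ S a + χ S h + sumOver S (move x′ a c) ≡ χ S c + χ S b + sumOver S x
      moved = begin-equality
        χ S a + χ S h + sumOver S (move x′ a c)     ≡⟨ xy∙z≈y∙xz (χ S a) (χ S h) _ ⟩
        χ S h + (χ S a + sumOver S (move x′ a c))   ≡⟨ cong (χ S h +_) (sumOver-move S x′ c 1≤x′a) ⟩
        χ S h + (χ S c + sumOver S x′)              ≡⟨ x∙yz≈y∙xz (χ S h) (χ S c) _ ⟩
        χ S c + (χ S h + sumOver S x′)              ≡⟨ cong (χ S c +_) (sumOver-move S x b 1≤xh) ⟩
        χ S c + (χ S b + sumOver S x)               ≡⟨ +-assoc (χ S c) _ _ ⟨
        χ S c + χ S b + sumOver S x                 ∎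

    h-to-b : 1 ≤ x′ h → μ⁻ x′ lv′ h ℚ.≤ μ⁺ x′ lv′ b
    h-to-b 1≤x′h = begin
      μ⁻ x′ lv′ h   ≤⟨ μ⁻-h 1≤x′h ⟩
      μ⁻ x lv h     ≤⟨ stable h b h≢b 1≤xh hb-ind ⟩
      μ⁺ x lv b     ≤⟨ μ⁺-b ⟩
      μ⁺ x′ lv′ b   ∎
      where open ℚₚ.≤-Reasoning

    h-to-other : ∀ c → c ≢ h → c ≢ b → 1 ≤ x′ h → Independent f (move x′ h c) →
                 μ⁻ x′ lv′ h ℚ.≤ μ⁺ x′ lv′ c
    h-to-other c c≢h c≢b 1≤x′h ind = begin
      μ⁻ x′ lv′ h   ≤⟨ μ⁻-h 1≤x′h ⟩
      μ⁻ x lv h     ≤⟨ stable h c (c≢h ∘ sym) 1≤xh (independent-move x-ind 1≤xh separated) ⟩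
      μ⁺ x lv c     ≡⟨ μ⁺-other c≢h c≢b ⟨
      μ⁺ x′ lv′ c   ∎
      where
      open ℚₚ.≤-Reasoning
      separated : ∀ S → Tight f x S → c ∈ S → h ∉ S → ⊥
      separated S tight-S c∈S h∉S with balance {S} tight-S 1≤x′h ind
      ... | le rewrite χ-∈ c∈S | χ-∉ h∉S = contradiction le λ ()

    b-to-h : 1 ≤ x′ b → μ⁻ x′ lv′ b ℚ.≤ μ⁺ x′ lv′ h
    b-to-h _ = ℚₚ.<⇒≤ (ℚₚ.≤-<-trans μ⁻-b μ⁺-h)

    b-to-other : ∀ c → c ≢ h → c ≢ b → 1 ≤ x′ b → Independent f (move x′ b c) →
                 μ⁻ x′ lv′ b ℚ.≤ μ⁺ x′ lv′ c
    b-to-other c c≢h c≢b 1≤x′b ind = begin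
      μ⁻ x′ lv′ b   ≤⟨ μ⁻-b ⟩
      μ⁺ x lv b     ≤⟨ b-min c c≢h (independent-move x-ind 1≤xh separated) ⟩
      μ⁺ x lv c     ≡⟨ μ⁺-other c≢h c≢b ⟨
      μ⁺ x′ lv′ c   ∎
      where
      open ℚₚ.≤-Reasoning
      separated : ∀ S → Tight f x S → c ∈ S → h ∉ S → ⊥
      separated S tight-S c∈S h∉S with balance {S} tight-S 1≤x′b ind
      ... | le rewrite χ-∈ c∈S | χ-∉ h∉S = 1+n≰n (≤-trans le (≤-reflexive (+-identityʳ _)))

    other-to-h : ∀ a → a ≢ h → a ≢ b → 1 ≤ x′ a → Independent f (move x′ a h) →
                 μ⁻ x′ lv′ a ℚ.≤ μ⁺ x′ lv′ h
    other-to-h a a≢h a≢b 1≤x′a ind = ℚₚ.<⇒≤ (begin-strict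
      μ⁻ x′ lv′ a   ≡⟨ μ⁻-other a≢h a≢b ⟩
      μ⁻ x lv a     ≤⟨ stable a b a≢b 1≤xa (independent-move x-ind 1≤xa separated) ⟩
      μ⁺ x lv b     <⟨ μ⁺-h ⟩
      μ⁺ x′ lv′ h   ∎)
      where
      open ℚₚ.≤-Reasoning
      1≤xa : 1 ≤ x a
      1≤xa = 1≤x-other a≢h a≢b 1≤x′a
      separated : ∀ S → Tight f x S → b ∈ S → a ∉ S → ⊥
      separated S tight-S b∈S a∉S with balance {S} tight-S 1≤x′a ind
      ... | le rewrite χ-∈ b∈S | χ-∉ a∉S = 1+n≰n (≤-trans (≤-reflexive (+-comm 1 (χ S h))) le)

    other-to-b : ∀ a → a ≢ h → a ≢ b → 1 ≤ x′ a → Independent f (move x′ a b) →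
                 μ⁻ x′ lv′ a ℚ.≤ μ⁺ x′ lv′ b
    other-to-b a a≢h a≢b 1≤x′a ind = begin
      μ⁻ x′ lv′ a   ≡⟨ μ⁻-other a≢h a≢b ⟩
      μ⁻ x lv a     ≤⟨ stable a b a≢b 1≤xa (independent-move x-ind 1≤xa separated) ⟩
      μ⁺ x lv b     ≤⟨ μ⁺-b ⟩
      μ⁺ x′ lv′ b   ∎
      where
      open ℚₚ.≤-Reasoning
      1≤xa : 1 ≤ x a
      1≤xa = 1≤x-other a≢h a≢b 1≤x′a
      separated : ∀ S → Tight f x S → b ∈ S → a ∉ S → ⊥
      separated S tight-S b∈S a∉S with balance {S} tight-S 1≤x′a ind
      ... | le rewrite χ-∈ b∈S | χ-∉ a∉S = contradiction (≤-trans le (χ≤1 S h)) λ { (s≤s ()) }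

    -- If a → c is blocked for x by a tight set U, then U ∪ W and U ∩ W show that no tight W
    -- blocks a → b or h → c.
    other-to-other-blocked : ∀ a c → a ≢ b → c ≢ h → 1 ≤ x a → 1 ≤ x′ a → Independent f (move x′ a c) →
                             ∀ U → Tight f x U → c ∈ U → a ∉ U → μ⁻ x lv a ℚ.≤ μ⁺ x lv c
    other-to-other-blocked a c a≢b c≢h 1≤xa 1≤x′a ind U tight-U c∈U a∉U = begin
      μ⁻ x lv a     ≤⟨ stable a b a≢b 1≤xa (independent-move x-ind 1≤xa separated-ab) ⟩
      μ⁺ x lv b     ≤⟨ b-min c c≢h (independent-move x-ind 1≤xh separated-hc) ⟩
      μ⁺ x lv c     ∎
      where
      open ℚₚ.≤-Reasoning
      separated-ab : ∀ W → Tight f x W → b ∈ W → a ∉ W → ⊥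
      separated-ab W tight-W b∈W a∉W with balance {U ∪ W} (proj₁ (tight-∪∩ f-poly x-ind tight-U tight-W)) 1≤x′a ind
      ... | le rewrite χ-∈ (x∈p∪q⁺ {p = U} {q = W} (inj₁ c∈U)) | χ-∈ (x∈p∪q⁺ {p = U} {q = W} (inj₂ b∈W))
                     | χ-∉ {U = U ∪ W} ([ a∉U , a∉W ]′ ∘ x∈p∪q⁻ U W)
        = contradiction (≤-trans le (χ≤1 (U ∪ W) h)) λ { (s≤s ()) }
      separated-hc : ∀ W → Tight f x W → c ∈ W → h ∉ W → ⊥
      separated-hc W tight-W c∈W h∉W with balance {U ∩ W} (proj₂ (tight-∪∩ f-poly x-ind tight-U tight-W)) 1≤x′a ind
      ... | le rewrite χ-∈ (x∈p∩q⁺ (c∈U , c∈W)) | χ-∉ {U = U ∩ W} (a∉U ∘ proj₁ ∘ x∈p∩q⁻ U W)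
                     | χ-∉ {U = U ∩ W} (h∉W ∘ proj₂ ∘ x∈p∩q⁻ U W)
        = contradiction le λ ()

    other-to-other : ∀ a c → a ≢ c → a ≢ h → a ≢ b → c ≢ h → c ≢ b → 1 ≤ x′ a → Independent f (move x′ a c) →
                     μ⁻ x′ lv′ a ℚ.≤ μ⁺ x′ lv′ c
    other-to-other a c a≢c a≢h a≢b c≢h c≢b 1≤x′a ind =
      ℚₚ.≤-trans (ℚₚ.≤-reflexive (μ⁻-other a≢h a≢b))
                 (ℚₚ.≤-trans μ⁻≤μ⁺ (ℚₚ.≤-reflexive (sym (μ⁺-other c≢h c≢b))))
      where
      1≤xa : 1 ≤ x a
      1≤xa = 1≤x-other a≢h a≢b 1≤x′a
      μ⁻≤μ⁺ : μ⁻ x lv a ℚ.≤ μ⁺ x lv c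
      μ⁻≤μ⁺ with Independent? f (move x a c)
      ... | yes ac-ind = stable a c a≢c 1≤xa ac-ind
      ... | no ¬ac-ind = let (U , tight-U , c∈U , a∉U) = move-violation⇒tight x-ind 1≤xa ¬ac-ind in
                         other-to-other-blocked a c a≢b c≢h 1≤xa 1≤x′a ind U tight-U c∈U a∉U

    stable-after : Stable x′ lv′
    stable-after a c a≢c with a ≟ h | c ≟ h | a ≟ b | c ≟ b
    ... | yes refl | yes refl | _        | _        = contradiction refl a≢c
    ... | yes refl | no c≢h   | _        | yes refl = λ 1≤x′h _ → h-to-b 1≤x′h
    ... | yes refl | no c≢h   | _        | no c≢b   = h-to-other c c≢h c≢b
    ... | no a≢h   | yes refl | yes refl | _        = λ 1≤x′b _ → b-to-h 1≤x′b
    ... | no a≢h   | yes refl | no a≢b   | _        = other-to-h a a≢h a≢b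
    ... | no a≢h   | no c≢h   | yes refl | yes refl = contradiction refl a≢c
    ... | no a≢h   | no c≢h   | yes refl | no c≢b   = b-to-other c c≢h c≢b
    ... | no a≢h   | no c≢h   | no a≢b   | yes refl = other-to-b a a≢h a≢b
    ... | no a≢h   | no c≢h   | no a≢b   | no c≢b   = other-to-other a c a≢c a≢h a≢b c≢h c≢b

balanced-< : ∀ {a c r s} → a + r ≡ c + s → s < r → a < c
balanced-< {a} {c} {r} {s} a+r≡c+s s<r = +-cancelʳ-< r a c (begin-strict
  a + r   ≡⟨ a+r≡c+s ⟩
  c + s   <⟨ +-monoʳ-< c s<r ⟩
  c + r   ∎)
  where open ≤-Reasoning

-- The potential and the game

indicator : ∀ {A : Set} → Dec A → ℕ
indicator (yes _) = 1
indicator (no _)  = 0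

indicator-mono : ∀ {A B : Set} (a? : Dec A) (b? : Dec B) → (A → B) → indicator a? ≤ indicator b?
indicator-mono (yes a) (yes _) _   = ≤-refl
indicator-mono (yes a) (no ¬b) A⇒B = contradiction (A⇒B a) ¬b
indicator-mono (no _)  _       _   = z≤n

indicator-yes : ∀ {A : Set} (a? : Dec A) → A → indicator a? ≡ 1
indicator-yes (yes _) _ = refl
indicator-yes (no ¬a) a = contradiction a ¬a

indicator-no : ∀ {A : Set} (a? : Dec A) → ¬ A → indicator a? ≡ 0
indicator-no (yes a) ¬a = contradiction a ¬a
indicator-no (no _)  _  = refl

-- slot e k is the cost of a (k+1)-th own unit on e when the total load on e is L e + 1.  A best
-- move h → b trades a unit in a dearer slot for one in a cheaper slot, so Ψ decreases.
module Potential {m : ℕ} (μ : Fin m → ℕ → ℕ → ℚ.ℚ) (B : ℕ) (L : Vector ℕ m) where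

  slot : Fin m → ℕ → ℚ.ℚ
  slot e k = μ e k (suc (L e) ∸ k)

  below : ℚ.ℚ → ℚ.ℚ → ℕ
  below p q = indicator (p ℚₚ.<? q)

  rank : Fin m → ℕ → ℕ
  rank e k = Σℕ m λ e′ → Σℕ B λ t → below (slot e′ (toℕ t)) (slot e k)

  rankSum : Fin m → ℕ → ℕ
  rankSum e zero    = 0
  rankSum e (suc k) = rankSum e k + rank e k

  Ψ : Vector ℕ m → ℕ
  Ψ v = Σℕ m λ e → rankSum e (v e)

  below-mono : ∀ p {q q′} → q ℚ.≤ q′ → below p q ≤ below p q′
  below-mono p {q} {q′} q≤q′ = indicator-mono (p ℚₚ.<? q) (p ℚₚ.<? q′) λ p<q → ℚₚ.<-≤-trans p<q q≤q′

  below-self : ∀ p → below p p ≡ 0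
  below-self p = indicator-no (p ℚₚ.<? p) (ℚₚ.<-irrefl refl)

  below-< : ∀ {p q} → p ℚ.< q → below p q ≡ 1
  below-< {p} {q} = indicator-yes (p ℚₚ.<? q)

  rank-mono-< : ∀ {e k e′ k′} → k < B → slot e k ℚ.< slot e′ k′ → rank e k < rank e′ k′
  rank-mono-< {e} {k} {e′} {k′} k<B lt =
    Σℕ-mono-< m e (λ _ → Σℕ-mono B λ _ → below-mono _ (ℚₚ.<⇒≤ lt))
      (Σℕ-mono-< B (fromℕ< k<B) (λ _ → below-mono _ (ℚₚ.<⇒≤ lt))
        (subst (λ i → below (slot e i) (slot e k) < below (slot e i) (slot e′ k′)) (sym (toℕ-fromℕ< k<B))
          (subst₂ _<_ (sym (below-self (slot e k))) (sym (below-< lt)) (s≤s z≤n))))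

  Ψ-move : ∀ (v : Vector ℕ m) {h b} → b ≢ h → 1 ≤ v h → Ψ (move v h b) + rank h (pred (v h)) ≡ Ψ v + rank b (v b)
  Ψ-move v {h} {b} b≢h 1≤vh = begin
    Ψ (move v h b) + rank h (pred (v h))          ≡⟨ cong (_+ rank h (pred (v h)))
                                                          (Σℕ-inc-step rankSum rank (λ _ _ → refl) (dec v h) b) ⟩
    Ψ (dec v h) + rank b (dec v h b) + rank h (pred (v h))
                                                  ≡⟨ xy∙z≈xz∙y (Ψ (dec v h)) _ _ ⟩
    Ψ (dec v h) + rank h (pred (v h)) + rank b (dec v h b)
                                                  ≡⟨ cong₂ _+_ Ψ-dec (cong (rank b) (sym (updateAt-minimal b h v b≢h))) ⟨
    Ψ v + rank b (v b)                            ∎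
    where
    open ≡-Reasoning
    Ψ-dec : Ψ v ≡ Ψ (dec v h) + rank h (pred (v h))
    Ψ-dec = begin
      Ψ v                                   ≡⟨ Σℕ-cong m (λ e → cong (rankSum e) (inc-dec 1≤vh e)) ⟨
      Ψ (inc (dec v h) h)                   ≡⟨ Σℕ-inc-step rankSum rank (λ _ _ → refl) (dec v h) h ⟩
      Ψ (dec v h) + rank h (dec v h h)      ≡⟨ cong (λ k → Ψ (dec v h) + rank h k) (updateAt-updates h v) ⟩
      Ψ (dec v h) + rank h (pred (v h))     ∎

suc∸pred : ∀ {k l} → 1 ≤ k → k ≤ suc l → suc l ∸ pred k ≡ suc (suc l ∸ k)
suc∸pred {suc k} _ (s≤s k≤l) = +-∸-assoc 1 k≤l

module _ {m : ℕ} where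

  level : Vector ℕ m → Vector ℕ m → Vector ℕ m
  level L v e = suc (L e) ∸ v e

  level-inc : ∀ {L v : Vector ℕ m} e → v e ≤ L e → level L v e ≡ suc (level L (inc v e) e)
  level-inc {L} {v} e ve≤Le = trans (+-∸-assoc 1 ve≤Le) (cong (λ k → suc (suc (L e) ∸ k)) (sym (updateAt-updates e v)))

  level-inc-other : ∀ {L v : Vector ℕ m} {e e′} → e′ ≢ e → level L (inc v e) e′ ≡ level L v e′
  level-inc-other {L} {v} {e} {e′} e′≢e = cong (suc (L e′) ∸_) (updateAt-minimal e′ e v e′≢e)

  level-move-source : ∀ {L v : Vector ℕ m} {h b} → h ≢ b → 1 ≤ v h → v h ≤ suc (L h) →
                      level L (move v h b) h ≡ suc (level L v h)
  level-move-source {L} {v} h≢b 1≤vh vh≤ = trans (cong (suc (L _) ∸_) (move-source v h≢b)) (suc∸pred 1≤vh vh≤)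

  level-move-target : ∀ {L v : Vector ℕ m} {h b} → h ≢ b → v b ≤ L b →
                      level L v b ≡ suc (level L (move v h b) b)
  level-move-target {L} {v} {h} {b} h≢b vb≤Lb =
    trans (+-∸-assoc 1 vb≤Lb) (cong (λ k → suc (suc (L b) ∸ k)) (sym (move-target v h≢b)))

  level-move-other : ∀ {L v : Vector ℕ m} {h b e} → e ≢ h → e ≢ b → level L (move v h b) e ≡ level L v e
  level-move-other {L} {v} e≢h e≢b = cong (suc (L _) ∸_) (move-other v e≢h e≢b)

  level-raise : ∀ {L v : Vector ℕ m} {h} → v h ≤ suc (L h) → level (inc L h) v ≗ inc (level L v) h
  level-raise {L} {v} {h} vh≤ e with e ≟ h
  ... | yes refl = begin
    suc (inc L e e) ∸ v e       ≡⟨ cong (λ k → suc k ∸ v e) (updateAt-updates e L) ⟩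
    suc (suc (L e)) ∸ v e       ≡⟨ +-∸-assoc 1 vh≤ ⟩
    suc (level L v e)           ≡⟨ updateAt-updates e (level L v) ⟨
    inc (level L v) e e         ∎
    where open ≡-Reasoning
  ... | no e≢h = trans (cong (λ k → suc k ∸ v e) (updateAt-minimal e h L e≢h)) (sym (updateAt-minimal e h (level L v) e≢h))

  inc-+-comm : ∀ (u w : Vector ℕ m) g e → u e + inc w g e ≡ inc u g e + w e
  inc-+-comm u w g e with e ≟ g
  ... | yes refl rewrite updateAt-updates e {suc} u | updateAt-updates e {suc} w = +-suc (u e) (w e)
  ... | no e≢g   rewrite updateAt-minimal e g {suc} u e≢g | updateAt-minimal e g {suc} w e≢g = refl

  inc-move-balance : ∀ (L v : Vector ℕ m) {h b} → h ≢ b → 1 ≤ v h → ∀ e → inc L h e + move v h b e ≡ inc L b e + v e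
  inc-move-balance L v {h} {b} h≢b 1≤vh e with e ≟ h | e ≟ b
  ... | yes refl | _
    rewrite updateAt-updates e {suc} L | updateAt-minimal e b {suc} L h≢b | move-source v h≢b
    = trans (sym (+-suc (L e) _)) (cong (L e +_) (suc-pred (v e) {{>-nonZero 1≤vh}}))
  ... | no e≢h | yes refl
    rewrite updateAt-minimal e h {suc} L e≢h | updateAt-updates e {suc} L | move-target v h≢b = +-suc (L e) (v e)
  ... | no e≢h | no e≢b
    rewrite updateAt-minimal e h {suc} L e≢h | updateAt-minimal e b {suc} L e≢b | move-other v e≢h e≢b = refl

module _ {n m : ℕ} where

  load : Profile n m → Vector ℕ m
  load x e = Σℕ n λ j → x j e

  deviate-same : ∀ (x : Profile n m) j y → deviate x j y j ≡ y
  deviate-same x j y with j ≟ j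
  ... | yes _  = refl
  ... | no j≢j = contradiction refl j≢j

  deviate-other : ∀ (x : Profile n m) {j} y {k} → k ≢ j → deviate x j y k ≡ x k
  deviate-other x {j} y {k} k≢j with k ≟ j
  ... | yes k≡j = contradiction k≡j k≢j
  ... | no _    = refl

  deviate-∀ : ∀ {P : Fin n → Vector ℕ m → Set} {x : Profile n m} {j y} →
              P j y → (∀ k → k ≢ j → P k (x k)) → ∀ k → P k (deviate x j y k)
  deviate-∀ {P} {x} {j} {y} Py Px k with k ≟ j
  ... | yes refl = Py
  ... | no k≢j   = Px k k≢j

  x≤load : ∀ (x : Profile n m) j e → x j e ≤ load x e
  x≤load x j e = term≤Σℕ n (λ k → x k e) j

  load-deviate-≗ : ∀ {x : Profile n m} {j y L′} → (∀ e → load x e + y e ≡ L′ e + x j e) → load (deviate x j y) ≗ L′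
  load-deviate-≗ {x} {j} {y} balance e = +-cancelʳ-≡ (x j e) _ _ (begin
    load (deviate x j y) e + x j e    ≡⟨ Σℕ-agree-except n _ _ j (λ k k≢j → cong (λ v → v e) (deviate-other x y k≢j)) ⟩
    load x e + deviate x j y j e      ≡⟨ cong (λ v → load x e + v e) (deviate-same x j y) ⟩
    load x e + y e                    ≡⟨ balance e ⟩
    _ + x j e                         ∎)
    where open ≡-Reasoning

  others-load : ∀ (x : Profile n m) j e → others x j e + x j e ≡ load x e
  others-load x j e = trans (Σℕ-agree-except n _ (λ k → x k e) j others-term) (trans (cong (load x e +_) own-term) (+-identityʳ _))
    where
    others-term : ∀ k → k ≢ j → (if does (k ≟ j) then 0 else x k e) ≡ x k e
    others-term k k≢j with k ≟ j
    ... | yes k≡j = contradiction k≡j k≢j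
    ... | no _    = refl
    own-term : (if does (j ≟ j) then 0 else x j e) ≡ 0
    own-term with j ≟ j
    ... | yes _  = refl
    ... | no j≢j = contradiction refl j≢j

  others-deviate : ∀ (x : Profile n m) j y → others (deviate x j y) j ≗ others x j
  others-deviate x j y e = Σℕ-cong n term
    where
    term : ∀ k → (if does (k ≟ j) then 0 else deviate x j y k e) ≡ (if does (k ≟ j) then 0 else x k e)
    term k with k ≟ j
    ... | yes _   = refl
    ... | no _    = refl

  level-load : ∀ (x : Profile n m) j e → level (load x) (x j) e ≡ suc (others x j e)
  level-load x j e = trans (cong (λ t → suc t ∸ x j e) (sym (others-load x j e))) (m+n∸n≡m (suc (others x j e)) (x j e))

module Game {n m : ℕ} (G : PolymatroidGame n m) where
  open PolymatroidGame G

  μ : Fin n → Fin m → ℕ → ℕ → ℚ.ℚ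
  μ j e = marginalTable (C j e)

  module Player (j : Fin n) = Stability (μ j) (λ e → marginalTable-regular (C-reg j e)) (f-poly j)
  module Pot (j : Fin n) (L : Vector ℕ m) = Potential (μ j) (suc (d j)) L

  FeasibleAt : Vector ℕ n → Profile n m → Set
  FeasibleAt δ x = ∀ j → InBase (f j) (δ j) (x j)

  StableAgainst : Vector ℕ m → Profile n m → Set
  StableAgainst L x = ∀ j → Player.Stable j (x j) (level L (x j))

  Equilibrium : Profile n m → Set
  Equilibrium x = StableAgainst (load x) x

  Invariant : Vector ℕ n → Vector ℕ m → Fin m → Profile n m → Set
  Invariant δ L h x = FeasibleAt δ x × load x ≗ inc L h × StableAgainst L x

  potential : Vector ℕ m → Profile n m → ℕ
  potential L x = Σℕ n λ j → Pot.Ψ j L (x j)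

  module Improve {δ L h x} (δ≤d : ∀ j → δ j ≤ d j) (inv : Invariant δ L h x) (j : Fin n) {c : Fin m}
                 (c≢h : c ≢ h) (1≤vh : 1 ≤ x j h) (hc-ind : Independent (f j) (move (x j) h c))
                 (c<h : Player.μ⁺ j (x j) (level L (x j)) c ℚ.< μ j h (pred (x j h)) (suc (level L (x j) h))) where
    open Player j

    feasible : FeasibleAt δ x
    feasible = proj₁ inv

    loads : load x ≗ inc L h
    loads = proj₁ (proj₂ inv)

    stable : StableAgainst L x
    stable = proj₂ (proj₂ inv)

    v lv : Vector ℕ m
    v  = x j
    lv = level L v

    best : ∃ λ b → (b ≢ h × Independent (f j) (move v h b)) ×
                   ∀ c′ → c′ ≢ h × Independent (f j) (move v h c′) → μ⁺ v lv b ℚ.≤ μ⁺ v lv c′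
    best = argminℚ (λ c′ → ¬? (c′ ≟ h) ×-dec Independent? (f j) (move v h c′)) (μ⁺ v lv) (c , c≢h , hc-ind)

    b : Fin m
    b = proj₁ best

    b≢h : b ≢ h
    b≢h = proj₁ (proj₁ (proj₂ best))

    hb-ind : Independent (f j) (move v h b)
    hb-ind = proj₂ (proj₁ (proj₂ best))

    b-min : ∀ c′ → c′ ≢ h → Independent (f j) (move v h c′) → μ⁺ v lv b ℚ.≤ μ⁺ v lv c′
    b-min c′ c′≢h ind = proj₂ (proj₂ best) c′ (c′≢h , ind)

    b<h : μ⁺ v lv b ℚ.< μ j h (pred (v h)) (suc (lv h))
    b<h = ℚₚ.≤-<-trans (b-min c c≢h hc-ind) c<h

    vh≤ : v h ≤ suc (L h)
    vh≤ = subst (v h ≤_) (trans (loads h) (updateAt-updates h L)) (x≤load x j h)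

    vb≤ : v b ≤ L b
    vb≤ = subst (v b ≤_) (trans (loads b) (updateAt-minimal b h L b≢h)) (x≤load x j b)

    v′ : Vector ℕ m
    v′ = move v h b

    x′ : Profile n m
    x′ = deviate x j v′

    stable′ : Stable v′ (level L v′)
    stable′ = BestMove.stable-after {lv = lv} {lv′ = level L v′} (proj₁ (feasible j)) (stable j) 1≤vh b≢h hb-ind b-min b<h
                (level-move-source {L = L} (b≢h ∘ sym) 1≤vh vh≤) (level-move-target {L = L} (b≢h ∘ sym) vb≤)
                (λ e e≢h e≢b → level-move-other {L = L} e≢h e≢b)

    invariant′ : Invariant δ L b x′
    invariant′ =
      deviate-∀ {P = λ k w → InBase (f k) (δ k) w}
        (hb-ind , trans (Σℕ-move v b 1≤vh) (proj₂ (feasible j))) (λ k _ → feasible k) ,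
      load-deviate-≗ {x = x} {j} {v′} (λ e → trans (cong (_+ v′ e) (loads e)) (inc-move-balance L v (b≢h ∘ sym) 1≤vh e)) ,
      deviate-∀ {P = λ k w → Player.Stable k w (level L w)} stable′ (λ k _ → stable k)

    Ψ-decreases : Pot.Ψ j L v′ < Pot.Ψ j L v
    Ψ-decreases = balanced-< (Pot.Ψ-move j L v b≢h 1≤vh) (Pot.rank-mono-< j L {b} {v b} {h} {pred (v h)} vb<B slot-lt)
      where
      vb<B : v b < suc (d j)
      vb<B = s≤s (≤-trans (term≤Σℕ m v b) (≤-trans (≤-reflexive (proj₂ (feasible j))) (δ≤d j)))
      level-h : suc (L h) ∸ pred (v h) ≡ suc (lv h)
      level-h = suc∸pred 1≤vh vh≤
      slot-lt : Pot.slot j L b (v b) ℚ.< Pot.slot j L h (pred (v h))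
      slot-lt = subst (λ l → μ⁺ v lv b ℚ.< μ j h (pred (v h)) l) (sym level-h) b<h

    potential-decreases : potential L x′ < potential L x
    potential-decreases = Σℕ-mono-< n j
      (deviate-∀ {P = λ k w → Pot.Ψ k L w ≤ Pot.Ψ k L (x k)} (<⇒≤ Ψ-decreases) (λ k _ → ≤-refl))
      (subst (λ w → Pot.Ψ j L w < Pot.Ψ j L v) (sym (deviate-same x j v′)) Ψ-decreases)

  improve : ∀ {δ L h x} → (∀ j → δ j ≤ d j) → Invariant δ L h x → ∀ j {a c} →
            Player.ImprovingMove j (x j) (level (load x) (x j)) a c →
            ∃₂ λ b x′ → Invariant δ L b x′ × potential L x′ < potential L x
  improve {δ} {L} {h} {x} δ≤d inv j {a} improving
    with Player.raised-improving-move j (proj₂ (proj₂ inv) j) (Player.ImprovingMove-≗ j raised improving)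
    where
    raised : level (load x) (x j) ≗ inc (level L (x j)) h
    raised e = trans (cong (λ t → suc t ∸ x j e) (proj₁ (proj₂ inv) e)) (level-raise {L = L} {v = x j} xh≤ e)
      where
      xh≤ : x j h ≤ suc (L h)
      xh≤ = subst (x j h ≤_) (trans (proj₁ (proj₂ inv) h) (updateAt-updates h L)) (x≤load x j h)
  ... | refl , c<h =
    let (h≢c , 1≤xh , hc-ind , _) = improving
        module I = Improve δ≤d inv j (h≢c ∘ sym) 1≤xh hc-ind c<h
    in I.b , I.x′ , I.invariant′ , I.potential-decreases

  stabilize : ∀ {δ L h x} → (∀ j → δ j ≤ d j) → Invariant δ L h x → ∃ λ x* → FeasibleAt δ x* × Equilibrium x*
  stabilize {δ} {L} δ≤d inv = go inv (<-wellFounded _)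
    where
    go : ∀ {h x} → Invariant δ L h x → Acc _<_ (potential L x) → ∃ λ x* → FeasibleAt δ x* × Equilibrium x*
    go {h} {x} inv (acc smaller) with any? (λ j → Player.improving? j (x j) (level (load x) (x j)))
    ... | no none = x , proj₁ inv , λ j → Player.¬improving⇒stable j {lv = level (load x) (x j)} λ move → none (j , move)
    ... | yes (j , _ , _ , improving) =
      let (_ , _ , inv′ , decreases) = improve δ≤d inv j improving in go inv′ (smaller decreases)

  module AddUnit {δ x} (δ≤d : ∀ j → δ j ≤ d j) (feasible : FeasibleAt δ x) (equilibrium : Equilibrium x)
                 {i : Fin n} (δi<di : δ i < d i) where
    open Player i

    T v lv : Vector ℕ m
    T  = load x
    v  = x i
    lv = level T v

    room : Σℕ m v < f i Sub.⊤
    room = subst (_< f i Sub.⊤) (sym (proj₂ (feasible i))) (<-≤-trans δi<di (d≤fE i))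

    best : ∃ λ g → Independent (f i) (inc v g) × ∀ c → Independent (f i) (inc v c) → μ⁺ v lv g ℚ.≤ μ⁺ v lv c
    best = argminℚ (λ c → Independent? (f i) (inc v c)) (μ⁺ v lv) (augmentation (f-poly i) (proj₁ (feasible i)) room)

    g : Fin m
    g = proj₁ best

    v′ : Vector ℕ m
    v′ = inc v g

    x′ : Profile n m
    x′ = deviate x i v′

    stable′ : Stable v′ (level T v′)
    stable′ = Augment.stable-after {lv = lv} {lv′ = level T v′} (equilibrium i) (proj₂ (proj₂ best))
                (level-inc {L = T} g (x≤load x i g)) (λ e e≢g → level-inc-other {L = T} e≢g)

    δ′≤d : ∀ k → inc δ i k ≤ d k
    δ′≤d k with k ≟ i
    ... | yes refl = subst (_≤ d k) (sym (updateAt-updates k δ)) δi<di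
    ... | no k≢i   = subst (_≤ d k) (sym (updateAt-minimal k i δ k≢i)) (δ≤d k)

    invariant′ : Invariant (inc δ i) T g x′
    invariant′ =
      deviate-∀ {P = λ k w → InBase (f k) (inc δ i k) w}
        (proj₁ (proj₂ best) , trans (Σℕ-inc v g) (trans (cong suc (proj₂ (feasible i))) (sym (updateAt-updates i δ))))
        (λ k k≢i → proj₁ (feasible k) , trans (proj₂ (feasible k)) (sym (updateAt-minimal k i δ k≢i))) ,
      load-deviate-≗ {x = x} {i} {v′} (inc-+-comm T v g) ,
      deviate-∀ {P = λ k w → Player.Stable k w (level T w)} stable′ (λ k _ → equilibrium k)

  add-unit : ∀ {δ x} → (∀ j → δ j ≤ d j) → FeasibleAt δ x → Equilibrium x → ∀ {i} → δ i < d i →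
             ∃ λ x* → FeasibleAt (inc δ i) x* × Equilibrium x*
  add-unit δ≤d feasible equilibrium δi<di =
    stabilize (AddUnit.δ′≤d δ≤d feasible equilibrium δi<di) (AddUnit.invariant′ δ≤d feasible equilibrium δi<di)

  FeasibleAt-≗ : ∀ {δ δ′ x} → δ ≗ δ′ → FeasibleAt δ x → FeasibleAt δ′ x
  FeasibleAt-≗ δ≗δ′ feasible j = proj₁ (feasible j) , trans (proj₂ (feasible j)) (δ≗δ′ j)

  equilibrium-for : ∀ k δ → (∀ j → δ j ≤ d j) → Σℕ n δ ≡ k → ∃ λ x → FeasibleAt δ x × Equilibrium x
  equilibrium-for zero δ _ Σδ≡0 = (λ _ _ → 0) , empty , λ j a c a≢c ()
    where
    empty : FeasibleAt δ (λ _ _ → 0)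
    empty j = (λ U → ≤-trans (sumOver≤Σℕ U _) (≤-trans (≤-reflexive (Σℕ-zero m)) z≤n)) ,
              trans (Σℕ-zero m) (sym (n≤0⇒n≡0 (subst (δ j ≤_) Σδ≡0 (term≤Σℕ n δ j))))
  equilibrium-for (suc k) δ δ≤d Σδ≡1+k =
    let (x , feasible , equilibrium) = equilibrium-for k δ₀ δ₀≤d Σδ₀≡k
        (x* , feasible* , equilibrium*) = add-unit δ₀≤d feasible equilibrium δ₀i<di
    in x* , FeasibleAt-≗ (inc-dec 0<δi) feasible* , equilibrium*
    where
    positive : ∃ λ i → 0 < δ i
    positive = Σℕ-positive n δ (subst (0 <_) (sym Σδ≡1+k) (s≤s z≤n))
    i : Fin n
    i = proj₁ positive
    0<δi : 0 < δ i
    0<δi = proj₂ positive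
    δ₀ : Vector ℕ n
    δ₀ = dec δ i
    δ₀≤d : ∀ j → δ₀ j ≤ d j
    δ₀≤d j = ≤-trans (dec≤ δ i j) (δ≤d j)
    δ₀i<di : δ₀ i < d i
    δ₀i<di = subst (_≤ d i) (sym (trans (cong suc (updateAt-updates i δ)) (suc-pred (δ i) {{>-nonZero 0<δi}}))) (δ≤d i)
    Σδ₀≡k : Σℕ n δ₀ ≡ k
    Σδ₀≡k = suc-injective (trans (sym (Σℕ-dec δ 0<δi)) Σδ≡1+k)

  equilibrium⇒NE : ∀ {x} → FeasibleAt d x → Equilibrium x → IsPureNE G x
  equilibrium⇒NE {x} feasible equilibrium = feasible , best-response
    where
    best-response : ∀ i y → InBase (f i) (d i) y → privateCost G x i ℚ.≤ privateCost G (deviate x i y) i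
    best-response i y y-base =
      ℚₚ.≤-trans (SC.locally-optimal⇒optimal (feasible i) locally-optimal y-base) (ℚₚ.≤-reflexive (sym deviation-cost))
      where
      K : Fin m → ℕ → ℚ.ℚ
      K e k = C i e k (others x i e)
      convex : ∀ e k → Δ K e k ℚ.≤ Δ K e (suc k)
      convex e k = ℚₚ.≤-trans (IsRegular.mono-t (C-reg i e) k _) (IsRegular.swap (C-reg i e) k _)
      module SC = SeparableConvex (f-poly i) (d≤fE i) K convex
      locally-optimal : SC.LocallyOptimal (x i)
      locally-optimal = Player.Stable-≗ i (level-load x i) (equilibrium i)
      deviation-cost : privateCost G (deviate x i y) i ≡ SC.Φ y
      deviation-cost = Σℚ-cong m λ e → cong₂ (C i e) (cong (λ w → w e) (deviate-same x i y)) (others-deviate x i y e)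

theorem5p1 : ∀ {n m : ℕ} (G : PolymatroidGame n m) → ∃ λ x → IsPureNE G x
theorem5p1 {n} G =
  let (x , feasible , equilibrium) = equilibrium-for (Σℕ n d) d (λ _ → ≤-refl) refl
  in x , equilibrium⇒NE feasible equilibrium
  where
  open PolymatroidGame G
  open Game G
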